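{- Let $q$ be a prime power and $n\ge 4$. The set of $q$-polynomials $\mathcal C_n=\{a_0X+a_1X^q+a_2X^{q^3}: a_0,a_1,a_2\in\mathbb F_{q^n}\}$ is an MRD code if and only if, for every $t\in\mathbb F_{q^n}$, the polynomial $Z^{q^2}+Z^q+tZ$ has at most $q$ roots in $\{y\in\mathbb F_{q^n}: \mathrm{Tr}_{q^n/q}(y)=0\}$.
   Context: A $q$-polynomial over $\mathbb F_{q^n}$ defines an $\mathbb F_q$-linear map of $\mathbb F_{q^n}$; fixing an $\mathbb F_q$-basis, sets of such polynomials are rank-metric codes in $\mathbb F_q^{n\times n}$ with distance $\mathrm{rank}(A-B)$. A code of minimum distance $d$ is MRD if its size is $q^{n(n-d+1)}$. $\mathrm{Tr}_{q^n/q}(y)=y+y^q+\dots+y^{q^{n-1}}$. -}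

module Defs where

open import Level using (0ℓ)
open import Data.Nat as ℕ using (ℕ; zero; suc; _≤_; _∸_)
open import Data.Nat.Primality using (Prime)
open import Data.Product using (Σ; ∃; _×_; _,_)
open import Data.List using (List; []; _∷_; length; map; filter; deduplicate; cartesianProduct; upTo)
open import Data.List.Membership.Propositional using (_∈_)
open import Data.List.Relation.Unary.Unique.Propositional using (Unique)
open import Data.List.Relation.Unary.All using (All; all?)
open import Relation.Binary.PropositionalEquality using (_≡_; _≢_)
open import Relation.Binary.Definitions using (DecidableEquality)
open import Relation.Nullary using (¬_; Dec)
open import Relation.Nullary.Decidable using (_×-dec_)
import Algebra.Structures as AS

PrimePower : ℕ → Set
PrimePower q = Σ ℕ λ p → Σ ℕ λ k → Prime p × 1 ≤ k × q ≡ p ℕ.^ k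

record FiniteField : Set₁ where
  infixl 6 _+_ _-_
  infixl 7 _*_
  field
    Carrier : Set
    _+_ _*_ : Carrier → Carrier → Carrier
    -_      : Carrier → Carrier
    0# 1#   : Carrier
    isCommutativeRing : AS.IsCommutativeRing {A = Carrier} _≡_ _+_ _*_ -_ 0# 1#
    0≢1     : 0# ≢ 1#
    inverse : ∀ x → x ≢ 0# → Σ Carrier λ y → x * y ≡ 1#
    _≟_     : DecidableEquality Carrier
    elems   : List Carrier
    complete : ∀ x → x ∈ elems
    unique  : Unique elems

  _-_ : Carrier → Carrier → Carrier
  x - y = x + (- y)

  card : ℕ
  card = length elems

  pow : Carrier → ℕ → Carrier
  pow x zero    = 1#
  pow x (suc m) = x * pow x m

  Σ< : ℕ → (ℕ → Carrier) → Carrier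
  Σ< zero    f = 0#
  Σ< (suc m) f = Σ< m f + f m

module _ (K : FiniteField) (q n : ℕ) where
  open FiniteField K

  frob : ℕ → Carrier → Carrier
  frob i x = pow x (q ℕ.^ i)

  Tr : Carrier → Carrier
  Tr y = Σ< n (λ i → frob i y)

  imageSize : (Carrier → Carrier) → ℕ
  imageSize f = length (deduplicate _≟_ (map f elems))

  -- rank over F_q of an F_q-linear map: its image is an F_q-space of dimension r,
  -- i.e. has q^r elements
  HasRank : (Carrier → Carrier) → ℕ → Set
  HasRank f r = imageSize f ≡ q ℕ.^ r

  SameMap : (Carrier → Carrier) → (Carrier → Carrier) → Set
  SameMap f g = ∀ x → f x ≡ g x

  sameMap? : (f g : Carrier → Carrier) → Dec (All (λ x → f x ≡ g x) elems)
  sameMap? f g = all? (λ x → f x ≟ g x) elems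

  record Code : Set₁ where
    field
      Index : Set
      indices : List Index
      complete-ix : ∀ i → i ∈ indices
      word : Index → Carrier → Carrier

  module _ (C : Code) where
    open Code C

    codeSize : ℕ
    codeSize = length (deduplicate (λ i j → sameMap? (word i) (word j)) indices)

    MinDistance : ℕ → Set
    MinDistance d =
      (Σ Index λ i → Σ Index λ j → ¬ SameMap (word i) (word j)
          × HasRank (λ x → word i x - word j x) d)
      × (∀ i j → ¬ SameMap (word i) (word j) → ∀ r →
          HasRank (λ x → word i x - word j x) r → d ≤ r)

    MRD : Set
    MRD = Σ ℕ λ d → MinDistance d × codeSize ≡ q ℕ.^ (n ℕ.* (n ∸ d ℕ.+ 1))

  Cn : Code
  Cn = record
    { Index = Carrier × Carrier × Carrier
    ; indices = cartesianProduct elems (cartesianProduct elems elems)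
    ; complete-ix = λ { (a , b , c) → ∈-cp (complete a) (∈-cp (complete b) (complete c)) }
    ; word = λ { (a0 , a1 , a2) x → a0 * x + a1 * frob 1 x + a2 * frob 3 x }
    }
    where
    open import Data.List.Membership.Propositional.Properties using () renaming (∈-cartesianProduct⁺ to ∈-cp)

  traceZeroRoots : Carrier → ℕ
  traceZeroRoots t =
    length (filter (λ y → (Tr y ≟ 0#) ×-dec ((frob 2 y + frob 1 y + t * y) ≟ 0#)) elems)

-- Write φ(x) = x^q − x and g_t(Z) = Z^(q²) + Z^q + tZ. Then g_t ∘ φ is the codeword
-- f_t = −tX + (t−1)X^q + X^(q³), and since φ is 𝔽_q-linear with kernel 𝔽_q and image the
-- trace-zero hyperplane, |ker f_t| = q·|V_t|, where V_t is the 𝔽_q-space of trace-zero roots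
-- of g_t. Conversely, a codeword with nonzero X^(q³)-coefficient and a nonzero root u becomes
-- λ·f_t after substituting uX for X, and a nonzero codeword without X^(q³)-term has at most q
-- roots. As |C_n| = q^(3n), C_n is MRD iff every nonzero codeword has rank ≥ n−2, i.e. at most
-- q² roots, and some pair attains n−2. So |V_t| ≤ q for all t gives MRD (and |V_t| = q for
-- t = −(y^(q²) + y^q)/y, y ≠ 0 of trace zero), while |V_t| > q forces |V_t| = q², since V_t
-- is a subspace inside the at most q² roots of g_t, and then f_t has rank n−3.

module Submission where

open import Defs
open import Level using (0ℓ)
open import Algebra.Structures using (IsCommutativeRing; IsCommutativeMonoid)
open import Data.Nat as ℕ using (ℕ; zero; suc; pred; _≤_; _<_; _∸_; _⊔_; _^_; z≤n; s≤s; NonZero)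
import Data.Nat.Properties as ℕ
open import Data.Nat.Primality using (Prime; prime⇒nonTrivial)
open import Data.Integer as ℤ using (ℤ)
open import Data.Product using (∃; _×_; _,_; proj₁; proj₂)
open import Data.Sum using (_⊎_; inj₁; inj₂)
open import Data.Unit using (⊤; tt)
open import Data.List using (List; []; _∷_; length; map; filter; foldr; cartesianProduct; deduplicate)
open import Data.List.Membership.Propositional using (_∈_)
open import Data.List.Membership.Propositional.Properties using (∈-filter⁺; ∈-filter⁻; ∈-map⁺; ∈-map⁻)
open import Data.List.Relation.Binary.Permutation.Propositional using (_↭_)
open import Data.List.Relation.Binary.Permutation.Propositional.Properties using (↭-length)
open import Data.List.Relation.Unary.Any as Any using (Any; here; there; any?)
open import Data.List.Relation.Unary.All as All using (All; []; _∷_)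
open import Data.List.Relation.Unary.AllPairs as AllPairs using (AllPairs; []; _∷_)
open import Data.List.Relation.Unary.Unique.Propositional using (Unique)
import Data.List.Relation.Unary.Unique.Propositional.Properties as Unique
open import Function.Base using (_∘_; case_of_)
open import Relation.Binary.PropositionalEquality
open import Relation.Binary.Definitions using (DecidableEquality)
open import Relation.Nullary using (¬_; Dec; yes; no; ¬?; contradiction)
open import Relation.Nullary.Decidable using (_×-dec_)
open import Relation.Unary using (Pred; Decidable; _⊆_; _∩_)
open import Relation.Unary.Properties using (_∩?_; ∁?; _×?_)

-- Algebra.Solver.Ring compares normal forms whose coefficients must compute, so they are
-- taken in ℤ and mapped into the ring. With the TC-optimised multiple used for that map,
-- con (ℤ.+ 1) denotes 1# itself.
module IntegerCoefficientSolver {A : Set} {plus times : A → A → A} {minus : A → A} {0ᴬ 1ᴬ : A}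
  (isCommutativeRing : IsCommutativeRing _≡_ plus times minus 0ᴬ 1ᴬ) where

  open import Algebra.Bundles using (CommutativeRing; RawRing)
  open import Algebra.Solver.Ring.AlmostCommutativeRing
    using (AlmostCommutativeRing; fromCommutativeRing; _-Raw-AlmostCommutative⟶_)
  import Algebra.Solver.Ring as Solver
  open import Data.Nat.Properties using (+-suc)
  open import Data.Integer using (-[1+_]; _⊖_)
  open import Data.Integer.Properties using ([1+m]⊖[1+n]≡m⊖n)
  open import Data.Sign as Sign using (Sign)
  open import Data.Maybe using (Maybe; just; nothing)

  commutativeRing : CommutativeRing _ _
  commutativeRing = record { isCommutativeRing = isCommutativeRing }

  open CommutativeRing commutativeRing
    using (_+_; _*_; -_; 0#; 1#; +-comm; +-assoc; +-identityˡ; +-identityʳ; -‿inverseʳ; ring; semiring; +-rawMonoid)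
  open import Algebra.Properties.Ring ring
    using (-‿involutive; -‿distribˡ-*; -‿distribʳ-*; -‿anti-homo-+; -0#≈0#)
  open import Algebra.Properties.Semiring.Mult.TCOptimised semiring
    using (1+×; ×-homo-+; ×1-homo-*) renaming (_×_ to _×ₙ_)
  open ≡-Reasoning

  ⟦_⟧ : ℤ → A
  ⟦ ℤ.+ n ⟧    = n ×ₙ 1#
  ⟦ -[1+ n ] ⟧ = - (suc n ×ₙ 1#)

  private
    signed : Sign → A → A
    signed Sign.+ x = x
    signed Sign.- x = - x

    ⟦◃⟧ : ∀ s n → ⟦ s ℤ.◃ n ⟧ ≡ signed s (n ×ₙ 1#)
    ⟦◃⟧ Sign.- zero    = sym -0#≈0#
    ⟦◃⟧ Sign.+ zero    = refl
    ⟦◃⟧ Sign.- (suc n) = refl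
    ⟦◃⟧ Sign.+ (suc n) = refl

    ⟦⟧-signed : ∀ i → ⟦ i ⟧ ≡ signed (ℤ.sign i) (ℤ.∣ i ∣ ×ₙ 1#)
    ⟦⟧-signed (ℤ.+ n)    = refl
    ⟦⟧-signed -[1+ n ]   = refl

    signed-* : ∀ s t x y → signed (s Sign.* t) (x * y) ≡ signed s x * signed t y
    signed-* Sign.- Sign.- x y = trans (sym (-‿involutive (x * y)))
                                   (trans (cong -_ (-‿distribʳ-* x y)) (-‿distribˡ-* x (- y)))
    signed-* Sign.- Sign.+ x y = -‿distribˡ-* x y
    signed-* Sign.+ Sign.- x y = -‿distribʳ-* x y
    signed-* Sign.+ Sign.+ x y = refl

    ⟦⊖⟧ : ∀ m n → ⟦ m ⊖ n ⟧ ≡ m ×ₙ 1# + - (n ×ₙ 1#)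
    ⟦⊖⟧ zero    zero    = sym (trans (cong (0# +_) -0#≈0#) (+-identityʳ 0#))
    ⟦⊖⟧ zero    (suc n) = sym (+-identityˡ _)
    ⟦⊖⟧ (suc m) zero    = sym (trans (cong (suc m ×ₙ 1# +_) -0#≈0#) (+-identityʳ _))
    ⟦⊖⟧ (suc m) (suc n) = begin
      ⟦ suc m ⊖ suc n ⟧                 ≡⟨ cong ⟦_⟧ ([1+m]⊖[1+n]≡m⊖n m n) ⟩
      ⟦ m ⊖ n ⟧                         ≡⟨ ⟦⊖⟧ m n ⟩
      m ×ₙ 1# + - (n ×ₙ 1#)             ≡⟨ cancel-1# (m ×ₙ 1#) (n ×ₙ 1#) ⟩
      (1# + m ×ₙ 1#) + - (1# + n ×ₙ 1#) ≡⟨ cong₂ (λ a b → a + - b) (1+× m 1#) (1+× n 1#) ⟨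
      suc m ×ₙ 1# + - (suc n ×ₙ 1#)     ∎
      where
      cancel-1# : ∀ a b → a + - b ≡ (1# + a) + - (1# + b)
      cancel-1# a b = begin
        a + - b                 ≡⟨ cong (_+ - b) (+-identityˡ a) ⟨
        (0# + a) + - b          ≡⟨ cong (λ z → (z + a) + - b) (-‿inverseʳ 1#) ⟨
        ((1# + - 1#) + a) + - b ≡⟨ cong (_+ - b) (+-assoc 1# (- 1#) a) ⟩
        (1# + (- 1# + a)) + - b ≡⟨ cong (λ z → (1# + z) + - b) (+-comm (- 1#) a) ⟩
        (1# + (a + - 1#)) + - b ≡⟨ cong (_+ - b) (+-assoc 1# a (- 1#)) ⟨
        ((1# + a) + - 1#) + - b ≡⟨ +-assoc (1# + a) (- 1#) (- b) ⟩
        (1# + a) + (- 1# + - b) ≡⟨ cong ((1# + a) +_) (+-comm (- 1#) (- b)) ⟩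
        (1# + a) + (- b + - 1#) ≡⟨ cong ((1# + a) +_) (-‿anti-homo-+ 1# b) ⟨
        (1# + a) + - (1# + b)   ∎

  ⟦⟧-homo-* : ∀ i j → ⟦ i ℤ.* j ⟧ ≡ ⟦ i ⟧ * ⟦ j ⟧
  ⟦⟧-homo-* i j = begin
    ⟦ i ℤ.* j ⟧                                             ≡⟨ ⟦◃⟧ (s Sign.* t) (ℤ.∣ i ∣ ℕ.* ℤ.∣ j ∣) ⟩
    signed (s Sign.* t) ((ℤ.∣ i ∣ ℕ.* ℤ.∣ j ∣) ×ₙ 1#)       ≡⟨ cong (signed (s Sign.* t)) (×1-homo-* ℤ.∣ i ∣ ℤ.∣ j ∣) ⟩
    signed (s Sign.* t) ((ℤ.∣ i ∣ ×ₙ 1#) * (ℤ.∣ j ∣ ×ₙ 1#)) ≡⟨ signed-* s t _ _ ⟩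
    signed s (ℤ.∣ i ∣ ×ₙ 1#) * signed t (ℤ.∣ j ∣ ×ₙ 1#)     ≡⟨ cong₂ _*_ (⟦⟧-signed i) (⟦⟧-signed j) ⟨
    ⟦ i ⟧ * ⟦ j ⟧                                           ∎
    where
    s t : Sign
    s = ℤ.sign i
    t = ℤ.sign j

  ⟦⟧-homo-+ : ∀ i j → ⟦ i ℤ.+ j ⟧ ≡ ⟦ i ⟧ + ⟦ j ⟧
  ⟦⟧-homo-+ -[1+ m ] -[1+ n ] = begin
    - (suc (suc (m ℕ.+ n)) ×ₙ 1#)     ≡⟨ cong (λ k → - (suc k ×ₙ 1#)) (+-suc m n) ⟨
    - ((suc m ℕ.+ suc n) ×ₙ 1#)       ≡⟨ cong -_ (×-homo-+ 1# (suc m) (suc n)) ⟩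
    - (suc m ×ₙ 1# + suc n ×ₙ 1#)     ≡⟨ -‿anti-homo-+ _ _ ⟩
    - (suc n ×ₙ 1#) + - (suc m ×ₙ 1#) ≡⟨ +-comm _ _ ⟩
    - (suc m ×ₙ 1#) + - (suc n ×ₙ 1#) ∎
  ⟦⟧-homo-+ -[1+ m ] (ℤ.+ n)   = trans (⟦⊖⟧ n (suc m)) (+-comm _ _)
  ⟦⟧-homo-+ (ℤ.+ m)  -[1+ n ]  = ⟦⊖⟧ m (suc n)
  ⟦⟧-homo-+ (ℤ.+ m)  (ℤ.+ n)   = ×-homo-+ 1# m n

  ⟦⟧-homo-- : ∀ i → ⟦ ℤ.- i ⟧ ≡ - ⟦ i ⟧
  ⟦⟧-homo-- -[1+ n ]      = sym (-‿involutive _)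
  ⟦⟧-homo-- (ℤ.+ zero)    = sym -0#≈0#
  ⟦⟧-homo-- (ℤ.+ (suc n)) = refl

  private
    ℤ-rawRing : RawRing _ _
    ℤ-rawRing = record
      { Carrier = ℤ ; _≈_ = _≡_ ; _+_ = ℤ._+_ ; _*_ = ℤ._*_ ; -_ = ℤ.-_ ; 0# = ℤ.+ 0 ; 1# = ℤ.+ 1 }

    ℤ⟶A : ℤ-rawRing -Raw-AlmostCommutative⟶ fromCommutativeRing commutativeRing
    ℤ⟶A = record
      { ⟦_⟧ = ⟦_⟧ ; +-homo = ⟦⟧-homo-+ ; *-homo = ⟦⟧-homo-* ; -‿homo = ⟦⟧-homo--
      ; 0-homo = refl ; 1-homo = refl }

    ⟦⟧-≟ : ∀ i j → Maybe (⟦ i ⟧ ≡ ⟦ j ⟧)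
    ⟦⟧-≟ i j with i ℤ.≟ j
    ... | yes i≡j = just (cong ⟦_⟧ i≡j)
    ... | no _    = nothing

  open Solver ℤ-rawRing (fromCommutativeRing commutativeRing) ℤ⟶A ⟦⟧-≟ public
    using (solve; _:+_; _:*_; :-_; _:-_; _:=_; con)


module ListCounting where
  open import Data.Nat using (_+_; _*_)
  open import Data.List using (_++_)
  open import Data.List.Properties using (length-filter; filter-all; filter-some; length-map; length-++)
  open import Data.List.Membership.Propositional.Properties using (∈-cartesianProduct⁺; ∈-cartesianProduct⁻)
  open import Data.List.Membership.Propositional.Properties.WithK using (unique∧set⇒bag)
  open import Data.List.Relation.Binary.BagAndSetEquality using (∼bag⇒↭)
  open import Function.Bundles using (mk⇔)
  open import Relation.Binary.Core using (Rel)
  import Relation.Binary.Definitions as Binary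

  module _ {A : Set} where

    ↭-of-same-elements : ∀ {xs ys : List A} → Unique xs → Unique ys →
      (∀ {z} → z ∈ xs → z ∈ ys) → (∀ {z} → z ∈ ys → z ∈ xs) → xs ↭ ys
    ↭-of-same-elements ux uy to from = ∼bag⇒↭ (unique∧set⇒bag ux uy (mk⇔ to from))

    length-≤-of-⊆ : DecidableEquality A → ∀ {xs ys : List A} → Unique xs → Unique ys →
      (∀ {z} → z ∈ xs → z ∈ ys) → length xs ≤ length ys
    length-≤-of-⊆ _≟_ {xs} {ys} ux uy xs⊆ys = begin
      length xs                   ≡⟨ ↭-length (↭-of-same-elements ux (Unique.filter⁺ (_∈? xs) uy) to from) ⟩
      length (filter (_∈? xs) ys) ≤⟨ length-filter (_∈? xs) ys ⟩
      length ys                   ∎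
      where
      open ℕ.≤-Reasoning
      open import Data.List.Membership.DecPropositional _≟_ using (_∈?_)
      to : ∀ {z} → z ∈ xs → z ∈ filter (_∈? xs) ys
      to z∈xs = ∈-filter⁺ (_∈? xs) (xs⊆ys z∈xs) z∈xs
      from : ∀ {z} → z ∈ filter (_∈? xs) ys → z ∈ xs
      from z∈ = proj₂ (∈-filter⁻ (_∈? xs) {xs = ys} z∈)

    map⁺-injectiveOn : ∀ {B : Set} {f : A → B} {xs} → Unique xs →
      (∀ {x y} → x ∈ xs → y ∈ xs → f x ≡ f y → x ≡ y) → Unique (map f xs)
    map⁺-injectiveOn {xs = []} [] _ = []
    map⁺-injectiveOn {f = f} {xs = x ∷ xs} (x∉ ∷ u) inj =
      All.map⁺ (All.tabulate λ z∈ fx≡fz → All.lookup x∉ z∈ (inj (here refl) (there z∈) fx≡fz))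
      ∷ map⁺-injectiveOn u (λ x∈ y∈ → inj (there x∈) (there y∈))
      where import Data.List.Relation.Unary.All.Properties as All

    map-↭-self : (f : A → A) {xs : List A} → Unique xs →
      (∀ {x y} → x ∈ xs → y ∈ xs → f x ≡ f y → x ≡ y) → (∀ {x} → x ∈ xs → f x ∈ xs) →
      (∀ {y} → y ∈ xs → ∃ λ x → x ∈ xs × f x ≡ y) → map f xs ↭ xs
    map-↭-self f {xs} u inj maps-into onto = ↭-of-same-elements (map⁺-injectiveOn u inj) u image⊆ ⊆image
      where
      image⊆ : ∀ {z} → z ∈ map f xs → z ∈ xs
      image⊆ z∈ with ∈-map⁻ f z∈
      ... | x , x∈ , refl = maps-into x∈
      ⊆image : ∀ {z} → z ∈ xs → z ∈ map f xs
      ⊆image z∈ with onto z∈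
      ... | x , x∈ , refl = ∈-map⁺ f x∈

    deduplicate-of-distinct : ∀ {R : Rel A 0ℓ} (R? : Binary.Decidable R) xs →
      AllPairs (λ a b → ¬ R a b) xs → deduplicate R? xs ≡ xs
    deduplicate-of-distinct R? [] _ = refl
    deduplicate-of-distinct R? (x ∷ xs) (x≁ ∷ ap) = cong (x ∷_) (begin
      filter (¬? ∘ R? x) (deduplicate R? xs) ≡⟨ cong (filter (¬? ∘ R? x)) (deduplicate-of-distinct R? xs ap) ⟩
      filter (¬? ∘ R? x) xs                  ≡⟨ filter-all (¬? ∘ R? x) x≁ ⟩
      xs                                     ∎)
      where open ≡-Reasoning

  length-cartesianProduct : ∀ {A B : Set} (xs : List A) (ys : List B) →
    length (cartesianProduct xs ys) ≡ length xs * length ys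
  length-cartesianProduct []       ys = refl
  length-cartesianProduct (x ∷ xs) ys = begin
    length (map (x ,_) ys ++ cartesianProduct xs ys)         ≡⟨ length-++ (map (x ,_) ys) ⟩
    length (map (x ,_) ys) + length (cartesianProduct xs ys) ≡⟨ cong₂ _+_ (length-map (x ,_) ys) (length-cartesianProduct xs ys) ⟩
    length ys + length xs * length ys                        ∎
    where open ≡-Reasoning

  record Enumeration (A : Set) : Set where
    field
      _≟_      : DecidableEquality A
      elements : List A
      complete : ∀ x → x ∈ elements
      unique   : Unique elements

  _×ᴱ_ : ∀ {A B : Set} → Enumeration A → Enumeration B → Enumeration (A × B)
  EA ×ᴱ EB = record
    { _≟_      = ≡-dec (Enumeration._≟_ EA) (Enumeration._≟_ EB)
    ; elements = cartesianProduct (Enumeration.elements EA) (Enumeration.elements EB)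
    ; complete = λ (a , b) → ∈-cartesianProduct⁺ (Enumeration.complete EA a) (Enumeration.complete EB b)
    ; unique   = Unique.cartesianProduct⁺ (Enumeration.unique EA) (Enumeration.unique EB)
    }
    where open import Data.Product.Properties using (≡-dec)

  module Counting {A : Set} (E : Enumeration A) where
    open Enumeration E

    count : {P : Pred A 0ℓ} → Decidable P → ℕ
    count P? = length (filter P? elements)

    count-all : count {λ _ → ⊤} (λ _ → yes tt) ≡ length elements
    count-all = cong length (filter-all (λ _ → yes tt) {xs = elements} (All.tabulate (λ _ → tt)))

    count-positive : ∀ {P : Pred A 0ℓ} (P? : Decidable P) {x} → P x → 0 < count P?
    count-positive P? {x} px = filter-some P? (Any.map (λ { refl → px }) (complete x))

    count-witness : ∀ {P : Pred A 0ℓ} (P? : Decidable P) → 0 < count P? → ∃ P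
    count-witness P? pos with filter P? elements in eq
    ... | x ∷ _ = x , proj₂ (∈-filter⁻ P? {xs = elements} (subst (x ∈_) (sym eq) (here refl)))

    count-split : ∀ {P R : Pred A 0ℓ} (P? : Decidable P) (R? : Decidable R) →
      count P? ≡ count (P? ∩? R?) + count (P? ∩? ∁? R?)
    count-split P? R? = go elements
      where
      go : ∀ xs → length (filter P? xs) ≡ length (filter (P? ∩? R?) xs) + length (filter (P? ∩? ∁? R?) xs)
      go [] = refl
      go (y ∷ ys) with P? y | R? y
      ... | yes _ | yes _ = cong suc (go ys)
      ... | yes _ | no _  = trans (cong suc (go ys)) (sym (ℕ.+-suc _ _))
      ... | no _  | yes _ = go ys
      ... | no _  | no _  = go ys

    count-≡-≤-1 : ∀ a → count (_≟ a) ≤ 1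
    count-≡-≤-1 a = length-≤-of-⊆ _≟_ (Unique.filter⁺ (_≟ a) unique) (All.[] ∷ [])
      (λ z∈ → here (proj₂ (∈-filter⁻ (_≟ a) {xs = elements} z∈)))

  module _ {A B : Set} (EA : Enumeration A) (EB : Enumeration B) where
    private
      module EA = Enumeration EA
      module EB = Enumeration EB
    open Counting

    count-≤-injection : ∀ {P : Pred A 0ℓ} {Q : Pred B 0ℓ} (P? : Decidable P) (Q? : Decidable Q) (f : A → B) →
      (∀ {x} → P x → Q (f x)) → (∀ {x y} → P x → P y → f x ≡ f y → x ≡ y) → count EA P? ≤ count EB Q?
    count-≤-injection {P} P? Q? f P⇒Qf inj = begin
      count EA P?                            ≡⟨ length-map f (filter P? EA.elements) ⟨
      length (map f (filter P? EA.elements)) ≤⟨ length-≤-of-⊆ EB._≟_ unique-image (Unique.filter⁺ Q? EB.unique) image⊆ ⟩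
      count EB Q?                            ∎
      where
      open ℕ.≤-Reasoning
      P-of : ∀ {x} → x ∈ filter P? EA.elements → P x
      P-of x∈ = proj₂ (∈-filter⁻ P? {xs = EA.elements} x∈)
      unique-image : Unique (map f (filter P? EA.elements))
      unique-image = map⁺-injectiveOn (Unique.filter⁺ P? EA.unique) (λ x∈ y∈ → inj (P-of x∈) (P-of y∈))
      image⊆ : ∀ {z} → z ∈ map f (filter P? EA.elements) → z ∈ filter Q? EB.elements
      image⊆ z∈ with ∈-map⁻ f z∈
      ... | x , x∈ , refl = ∈-filter⁺ Q? (EB.complete (f x)) (P⇒Qf (P-of x∈))

    count-× : ∀ {P : Pred A 0ℓ} {Q : Pred B 0ℓ} (P? : Decidable P) (Q? : Decidable Q) →
      count (EA ×ᴱ EB) (P? ×? Q?) ≡ count EA P? * count EB Q?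
    count-× P? Q? = begin
      length (filter (P? ×? Q?) (cartesianProduct EA.elements EB.elements))
        ≡⟨ ↭-length (↭-of-same-elements (Unique.filter⁺ (P? ×? Q?) (Enumeration.unique (EA ×ᴱ EB)))
                      (Unique.cartesianProduct⁺ (Unique.filter⁺ P? EA.unique) (Unique.filter⁺ Q? EB.unique)) to from) ⟩
      length (cartesianProduct (filter P? EA.elements) (filter Q? EB.elements))
        ≡⟨ length-cartesianProduct (filter P? EA.elements) (filter Q? EB.elements) ⟩
      count EA P? * count EB Q? ∎
      where
      open ≡-Reasoning
      to : ∀ {z} → z ∈ filter (P? ×? Q?) (cartesianProduct EA.elements EB.elements) →
           z ∈ cartesianProduct (filter P? EA.elements) (filter Q? EB.elements)
      to {a , b} z∈ with ∈-filter⁻ (P? ×? Q?) {xs = cartesianProduct EA.elements EB.elements} z∈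
      ... | _ , pa , qb = ∈-cartesianProduct⁺ (∈-filter⁺ P? (EA.complete a) pa) (∈-filter⁺ Q? (EB.complete b) qb)
      from : ∀ {z} → z ∈ cartesianProduct (filter P? EA.elements) (filter Q? EB.elements) →
             z ∈ filter (P? ×? Q?) (cartesianProduct EA.elements EB.elements)
      from {a , b} z∈ with ∈-cartesianProduct⁻ (filter P? EA.elements) (filter Q? EB.elements) z∈
      ... | a∈ , b∈ = ∈-filter⁺ (P? ×? Q?) (Enumeration.complete (EA ×ᴱ EB) (a , b))
                        (proj₂ (∈-filter⁻ P? {xs = EA.elements} a∈) , proj₂ (∈-filter⁻ Q? {xs = EB.elements} b∈))

  module _ {A : Set} (E : Enumeration A) where
    open Counting

    count-mono : ∀ {P Q : Pred A 0ℓ} (P? : Decidable P) (Q? : Decidable Q) → P ⊆ Q → count E P? ≤ count E Q?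
    count-mono P? Q? P⊆Q = count-≤-injection E E P? Q? (λ x → x) P⊆Q (λ _ _ eq → eq)

    count-cong : ∀ {P Q : Pred A 0ℓ} (P? : Decidable P) (Q? : Decidable Q) → P ⊆ Q → Q ⊆ P → count E P? ≡ count E Q?
    count-cong P? Q? P⊆Q Q⊆P = ℕ.≤-antisym (count-mono P? Q? P⊆Q) (count-mono Q? P? Q⊆P)

    count<⇒∃-difference : ∀ {P R : Pred A 0ℓ} (P? : Decidable P) (R? : Decidable R) →
      count E R? < count E P? → ∃ λ x → P x × ¬ R x
    count<⇒∃-difference P? R? #R<#P = count-witness E (P? ∩? ∁? R?) (ℕ.≰⇒> λ #P∖R≤0 → ℕ.<⇒≱ #R<#P (begin
      count E P?                                 ≡⟨ count-split E P? R? ⟩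
      count E (P? ∩? R?) + count E (P? ∩? ∁? R?) ≤⟨ ℕ.+-mono-≤ (count-mono (P? ∩? R?) R? proj₂) #P∖R≤0 ⟩
      count E R? + 0                             ≡⟨ ℕ.+-identityʳ _ ⟩
      count E R?                                 ∎))
      where open ℕ.≤-Reasoning


open ListCounting

module BinomialCoefficient where
  open import Data.Nat
  open import Data.Nat.Properties
  open import Data.Nat.Combinatorics using (_C_; nCk+nC[k+1]≡[n+1]C[k+1]; nC1≡n)
  open import Data.Nat.Divisibility using (_∣_; divides; ∣⇒≤)
  open import Data.Nat.Primality using (euclidsLemma)
  open import Data.Nat.Solver using (module +-*-Solver)

  [1+k]*[1+n]C[1+k]≡[1+n]*nCk : ∀ n k → suc k * (suc n C suc k) ≡ suc n * (n C k)
  [1+k]*[1+n]C[1+k]≡[1+n]*nCk zero    zero    = refl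
  [1+k]*[1+n]C[1+k]≡[1+n]*nCk zero    (suc k) = *-zeroʳ (2 + k)
  [1+k]*[1+n]C[1+k]≡[1+n]*nCk (suc n) zero    = begin
    1 * ((2 + n) C 1)     ≡⟨ *-identityˡ _ ⟩
    (2 + n) C 1           ≡⟨ nC1≡n (2 + n) ⟩
    2 + n                 ≡⟨ *-identityʳ (2 + n) ⟨
    (2 + n) * 1           ≡⟨⟩
    (2 + n) * (suc n C 0) ∎
    where open ≡-Reasoning
  [1+k]*[1+n]C[1+k]≡[1+n]*nCk (suc n) (suc k) = begin
    (2 + k) * ((2 + n) C (2 + k))             ≡⟨ cong ((2 + k) *_) (nCk+nC[k+1]≡[n+1]C[k+1] (suc n) (suc k)) ⟨
    (2 + k) * (a + b)                         ≡⟨ solve 3 (λ k a b → (con 2 :+ k) :* (a :+ b) := a :+ (con 1 :+ k) :* a :+ (con 2 :+ k) :* b) refl k a b ⟩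
    a + suc k * a + (2 + k) * b               ≡⟨ cong₂ (λ u v → a + u + v) ([1+k]*[1+n]C[1+k]≡[1+n]*nCk n k) ([1+k]*[1+n]C[1+k]≡[1+n]*nCk n (suc k)) ⟩
    a + suc n * (n C k) + suc n * (n C suc k) ≡⟨ solve 4 (λ n a c d → a :+ (con 1 :+ n) :* c :+ (con 1 :+ n) :* d := a :+ (con 1 :+ n) :* (c :+ d)) refl n a (n C k) (n C suc k) ⟩
    a + suc n * (n C k + n C suc k)           ≡⟨ cong (λ c → a + suc n * c) (nCk+nC[k+1]≡[n+1]C[k+1] n k) ⟩
    (2 + n) * a                               ∎
    where
    open ≡-Reasoning
    open +-*-Solver
    a b : ℕ
    a = suc n C suc k
    b = suc n C (2 + k)

  p∣pCk : ∀ {p} → Prime p → ∀ {k} → 0 < k → k < p → p ∣ p C k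
  p∣pCk {suc n} p-prime {suc k} _ k<p
    with euclidsLemma (suc k) (suc n C suc k) p-prime
           (divides (n C k) (trans ([1+k]*[1+n]C[1+k]≡[1+n]*nCk n k) (*-comm (suc n) (n C k))))
  ... | inj₁ p∣k = contradiction (∣⇒≤ p∣k) (<⇒≱ k<p)
  ... | inj₂ p∣C = p∣C


open BinomialCoefficient using (p∣pCk)

module FieldTheory (K : FiniteField) where
  open import Algebra.Bundles using (CommutativeRing)
  open import Data.Nat.Combinatorics using (_C_; nCn≡1)
  open import Data.Nat.Divisibility using (_∣_; divides)
  open import Data.Fin as Fin using (Fin; toℕ)
  open import Data.Fin.Properties using (toℕ-fromℕ; toℕ-inject₁; toℕ<n)
  open import Data.List.Relation.Binary.Permutation.Propositional using (↭⇒↭ₛ)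
  open import Data.List.Relation.Unary.Unique.DecPropositional.Properties using (deduplicate-!)
  open import Data.List.Membership.Propositional.Properties using (deduplicate-∈⇔)
  open import Function.Bundles using (Equivalence)

  open FiniteField K public

  commutativeRing : CommutativeRing 0ℓ 0ℓ
  commutativeRing = record { isCommutativeRing = isCommutativeRing }

  open CommutativeRing commutativeRing public
    using (+-comm; +-assoc; *-comm; *-assoc; +-identityˡ; +-identityʳ; *-identityˡ; *-identityʳ;
           -‿inverseʳ; distribˡ; zeroˡ; zeroʳ; semiring; commutativeSemiring; +-isCommutativeMonoid; *-isCommutativeMonoid; ring)
  open import Algebra.Properties.Ring ring public using (-0#≈0#)
  open import Algebra.Properties.Group (CommutativeRing.+-group commutativeRing) public
    using (x∙y⁻¹≈ε⇒x≈y; x≈y⇒x∙y⁻¹≈ε) renaming (∙-cancelˡ to +-cancelˡ; ∙-cancelʳ to +-cancelʳ)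
  open import Algebra.Properties.Semiring.Exp semiring using (^-assocʳ) renaming (_^_ to _^ᴷ_)
  open import Algebra.Properties.CommutativeSemiring.Exp commutativeSemiring using (^-distrib-*)
  open import Algebra.Properties.Semiring.Mult semiring using (×1-homo-*; ×-assoc-*; ×-assocˡ)
  open import Algebra.Properties.Semiring.Sum semiring using (sum; sum-init-last; sum-cong-≗; sum-replicate-zero)
  import Algebra.Properties.CommutativeSemiring.Binomial commutativeSemiring as BinomialTheorem
  open import Algebra.Definitions.RawMonoid (CommutativeRing.+-rawMonoid commutativeRing) public
    using () renaming (_×_ to _×ₙ_)
  open IntegerCoefficientSolver isCommutativeRing public using (solve; _:+_; _:*_; :-_; _:-_; _:=_; con)
  open ≡-Reasoning

  1≢0 : 1# ≢ 0#
  1≢0 = 0≢1 ∘ sym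

  x-y≡0⇒x≡y : ∀ {x y} → x - y ≡ 0# → x ≡ y
  x-y≡0⇒x≡y = x∙y⁻¹≈ε⇒x≈y _ _

  x≡y⇒x-y≡0 : ∀ {x y} → x ≡ y → x - y ≡ 0#
  x≡y⇒x-y≡0 = x≈y⇒x∙y⁻¹≈ε

  inv : ∀ x → x ≢ 0# → Carrier
  inv x x≢0 = proj₁ (inverse x x≢0)

  x*inv≡1 : ∀ x (x≢0 : x ≢ 0#) → x * inv x x≢0 ≡ 1#
  x*inv≡1 x x≢0 = proj₂ (inverse x x≢0)

  inv≢0 : ∀ x (x≢0 : x ≢ 0#) → inv x x≢0 ≢ 0#
  inv≢0 x x≢0 inv≡0 = 0≢1 (begin
    0#            ≡⟨ zeroʳ x ⟨
    x * 0#        ≡⟨ cong (x *_) inv≡0 ⟨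
    x * inv x x≢0 ≡⟨ x*inv≡1 x x≢0 ⟩
    1#            ∎)

  x*[inv*y]≡y : ∀ x (x≢0 : x ≢ 0#) y → x * (inv x x≢0 * y) ≡ y
  x*[inv*y]≡y x x≢0 y = begin
    x * (inv x x≢0 * y) ≡⟨ *-assoc x _ y ⟨
    (x * inv x x≢0) * y ≡⟨ cong (_* y) (x*inv≡1 x x≢0) ⟩
    1# * y              ≡⟨ *-identityˡ y ⟩
    y                   ∎

  x*y≡0⇒x≡0∨y≡0 : ∀ {x y} → x * y ≡ 0# → x ≡ 0# ⊎ y ≡ 0#
  x*y≡0⇒x≡0∨y≡0 {x} {y} xy≡0 with x ≟ 0#
  ... | yes x≡0 = inj₁ x≡0
  ... | no x≢0  = inj₂ (begin
    y                   ≡⟨ x*[inv*y]≡y x x≢0 y ⟨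
    x * (inv x x≢0 * y) ≡⟨ solve 3 (λ x i y → x :* (i :* y) := i :* (x :* y)) refl x (inv x x≢0) y ⟩
    inv x x≢0 * (x * y) ≡⟨ cong (inv x x≢0 *_) xy≡0 ⟩
    inv x x≢0 * 0#      ≡⟨ zeroʳ _ ⟩
    0#                  ∎)

  x*y≢0 : ∀ {x y} → x ≢ 0# → y ≢ 0# → x * y ≢ 0#
  x*y≢0 x≢0 y≢0 xy≡0 with x*y≡0⇒x≡0∨y≡0 xy≡0
  ... | inj₁ x≡0 = x≢0 x≡0
  ... | inj₂ y≡0 = y≢0 y≡0

  x*y≡0⇒y≡0 : ∀ {x y} → x ≢ 0# → x * y ≡ 0# → y ≡ 0#
  x*y≡0⇒y≡0 x≢0 xy≡0 with x*y≡0⇒x≡0∨y≡0 xy≡0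
  ... | inj₁ x≡0 = contradiction x≡0 x≢0
  ... | inj₂ y≡0 = y≡0

  *-cancelˡ : ∀ {a x y} → a ≢ 0# → a * x ≡ a * y → x ≡ y
  *-cancelˡ {a} {x} {y} a≢0 ax≡ay
    with x*y≡0⇒x≡0∨y≡0 (trans (solve 3 (λ a x y → a :* (x :- y) := a :* x :- a :* y) refl a x y) (x≡y⇒x-y≡0 ax≡ay))
  ... | inj₁ a≡0   = contradiction a≡0 a≢0
  ... | inj₂ x-y≡0 = x-y≡0⇒x≡y x-y≡0

  *-cancelʳ : ∀ {a x y} → a ≢ 0# → x * a ≡ y * a → x ≡ y
  *-cancelʳ {a} {x} {y} a≢0 xa≡ya = *-cancelˡ a≢0 (trans (*-comm a x) (trans xa≡ya (*-comm y a)))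

  x+y≡y⇒x≡0 : ∀ {x y} → x + y ≡ y → x ≡ 0#
  x+y≡y⇒x≡0 {x} {y} x+y≡y = +-cancelʳ y x 0# (trans x+y≡y (sym (+-identityˡ y)))

  pow≡^ : ∀ x n → pow x n ≡ x ^ᴷ n
  pow≡^ x zero    = refl
  pow≡^ x (suc n) = cong (x *_) (pow≡^ x n)

  pow-assocʳ : ∀ x m n → pow (pow x m) n ≡ pow x (m ℕ.* n)
  pow-assocʳ x m n rewrite pow≡^ (pow x m) n | pow≡^ x m | pow≡^ x (m ℕ.* n) = ^-assocʳ x m n

  pow-distrib-* : ∀ x y n → pow (x * y) n ≡ pow x n * pow y n
  pow-distrib-* x y n rewrite pow≡^ (x * y) n | pow≡^ x n | pow≡^ y n = ^-distrib-* x y n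

  pow-1# : ∀ n → pow 1# n ≡ 1#
  pow-1# zero    = refl
  pow-1# (suc n) = trans (*-identityˡ _) (pow-1# n)

  pow-≢0 : ∀ {x} n → x ≢ 0# → pow x n ≢ 0#
  pow-≢0 zero    x≢0 = 1≢0
  pow-≢0 (suc n) x≢0 = x*y≢0 x≢0 (pow-≢0 n x≢0)

  pow≡0⇒≡0 : ∀ {x} n → pow x n ≡ 0# → x ≡ 0#
  pow≡0⇒≡0 {x} n xⁿ≡0 with x ≟ 0#
  ... | yes x≡0 = x≡0
  ... | no x≢0  = contradiction xⁿ≡0 (pow-≢0 n x≢0)

  pow-×1# : ∀ m e → pow (m ×ₙ 1#) e ≡ (m ℕ.^ e) ×ₙ 1#
  pow-×1# m zero    = sym (+-identityʳ 1#)
  pow-×1# m (suc e) = trans (cong ((m ×ₙ 1#) *_) (pow-×1# m e)) (sym (×1-homo-* m (m ℕ.^ e)))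

  enumeration : Enumeration Carrier
  enumeration = record { _≟_ = _≟_ ; elements = elems ; complete = complete ; unique = unique }

  open Counting enumeration public

  private
    sumList productList : List Carrier → Carrier
    sumList     = foldr _+_ 0#
    productList = foldr _*_ 1#

    foldr-↭ : ∀ {_∙_ ε} → IsCommutativeMonoid _≡_ _∙_ ε → ∀ {xs ys} → xs ↭ ys → foldr _∙_ ε xs ≡ foldr _∙_ ε ys
    foldr-↭ isCM xs↭ys = Permutation.foldr-commMonoid isCM (↭⇒↭ₛ xs↭ys)
      where import Data.List.Relation.Binary.Permutation.Setoid.Properties (setoid Carrier) as Permutation

  card×x≡0 : ∀ x → card ×ₙ x ≡ 0#
  card×x≡0 x = x+y≡y⇒x≡0 (begin
    card ×ₙ x + sumList elems  ≡⟨ sum-translate elems ⟨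
    sumList (map (x +_) elems) ≡⟨ foldr-↭ +-isCommutativeMonoid (map-↭-self (x +_) unique (λ _ _ → +-cancelˡ x _ _) (λ _ → complete _) onto) ⟩
    sumList elems              ∎)
    where
    sum-translate : ∀ xs → sumList (map (x +_) xs) ≡ length xs ×ₙ x + sumList xs
    sum-translate []       = sym (+-identityˡ 0#)
    sum-translate (y ∷ ys) = trans (cong ((x + y) +_) (sum-translate ys))
      (solve 4 (λ x y a b → (x :+ y) :+ (a :+ b) := (x :+ a) :+ (y :+ b)) refl x y (length ys ×ₙ x) (sumList ys))
    onto : ∀ {y} → y ∈ elems → ∃ λ z → z ∈ elems × x + z ≡ y
    onto {y} _ = y - x , complete _ , solve 2 (λ x y → x :+ (y :- x) := y) refl x y

  characteristic : ∀ p e → 1 ≤ e → card ≡ p ℕ.^ e → p ×ₙ 1# ≡ 0#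
  characteristic p (suc e) _ card≡pᵉ = pow≡0⇒≡0 (suc e) (begin
    pow (p ×ₙ 1#) (suc e) ≡⟨ pow-×1# p (suc e) ⟩
    (p ℕ.^ suc e) ×ₙ 1#   ≡⟨ cong (_×ₙ 1#) card≡pᵉ ⟨
    card ×ₙ 1#            ≡⟨ card×x≡0 1# ⟩
    0#                    ∎)

  units : List Carrier
  units = filter (∁? (_≟ 0#)) elems

  private
    ∈units⁺ : ∀ {x} → x ≢ 0# → x ∈ units
    ∈units⁺ {x} x≢0 = ∈-filter⁺ (∁? (_≟ 0#)) (complete x) x≢0

    ∈units⁻ : ∀ {x} → x ∈ units → x ≢ 0#
    ∈units⁻ x∈ = proj₂ (∈-filter⁻ (∁? (_≟ 0#)) {xs = elems} x∈)

    units-unique : Unique units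
    units-unique = Unique.filter⁺ (∁? (_≟ 0#)) unique

  card≡1+#units : card ≡ suc (length units)
  card≡1+#units = ↭-length (↭-of-same-elements unique (All.tabulate (λ x∈ → ∈units⁻ x∈ ∘ sym) ∷ units-unique)
    (λ {x} _ → case x ≟ 0# of λ { (yes refl) → here refl ; (no x≢0) → there (∈units⁺ x≢0) })
    (λ _ → complete _))

  x^#units≡1 : ∀ {x} → x ≢ 0# → pow x (length units) ≡ 1#
  x^#units≡1 {x} x≢0 = *-cancelʳ (product≢0 units (λ x∈ → ∈units⁻ x∈)) (begin
    pow x (length units) * productList units ≡⟨ product-scale units ⟨
    productList (map (x *_) units)           ≡⟨ foldr-↭ *-isCommutativeMonoid (map-↭-self (x *_) units-unique (λ _ _ → *-cancelˡ x≢0) maps-into onto) ⟩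
    productList units                        ≡⟨ *-identityˡ _ ⟨
    1# * productList units                   ∎)
    where
    product-scale : ∀ xs → productList (map (x *_) xs) ≡ pow x (length xs) * productList xs
    product-scale []       = sym (*-identityˡ 1#)
    product-scale (y ∷ ys) = trans (cong ((x * y) *_) (product-scale ys))
      (solve 4 (λ x y a b → (x :* y) :* (a :* b) := (x :* a) :* (y :* b)) refl x y (pow x (length ys)) (productList ys))
    product≢0 : ∀ xs → (∀ {y} → y ∈ xs → y ≢ 0#) → productList xs ≢ 0#
    product≢0 []       _   = 1≢0
    product≢0 (y ∷ ys) ≢0 = x*y≢0 (≢0 (here refl)) (product≢0 ys (≢0 ∘ there))
    maps-into : ∀ {y} → y ∈ units → x * y ∈ units
    maps-into y∈ = ∈units⁺ (x*y≢0 x≢0 (∈units⁻ y∈))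
    onto : ∀ {y} → y ∈ units → ∃ λ z → z ∈ units × x * z ≡ y
    onto {y} y∈ = inv x x≢0 * y , ∈units⁺ (x*y≢0 (inv≢0 x x≢0) (∈units⁻ y∈)) , x*[inv*y]≡y x x≢0 y

  fermat : ∀ x → pow x card ≡ x
  fermat x with x ≟ 0#
  ... | yes refl = trans (cong (pow 0#) card≡1+#units) (zeroˡ _)
  ... | no x≢0   = begin
    pow x card               ≡⟨ cong (pow x) card≡1+#units ⟩
    x * pow x (length units) ≡⟨ cong (x *_) (x^#units≡1 x≢0) ⟩
    x * 1#                   ≡⟨ *-identityʳ x ⟩
    x                        ∎

  p∣m⇒m×x≡0 : ∀ {p} → p ×ₙ 1# ≡ 0# → ∀ {m} x → p ∣ m → m ×ₙ x ≡ 0#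
  p∣m⇒m×x≡0 {p} p≡0 x (divides c refl) = begin
    (c ℕ.* p) ×ₙ x ≡⟨ cong (_×ₙ x) (ℕ.*-comm c p) ⟩
    (p ℕ.* c) ×ₙ x ≡⟨ ×-assocˡ x p c ⟨
    p ×ₙ (c ×ₙ x)  ≡⟨ cong (p ×ₙ_) (*-identityˡ _) ⟨
    p ×ₙ (1# * y)  ≡⟨ ×-assoc-* p 1# y ⟨
    (p ×ₙ 1#) * y  ≡⟨ cong (_* y) p≡0 ⟩
    0# * y         ≡⟨ zeroˡ y ⟩
    0#             ∎
    where
    y : Carrier
    y = c ×ₙ x

  frobenius-additive : ∀ {p} → Prime p → p ×ₙ 1# ≡ 0# → ∀ x y → pow (x + y) p ≡ pow x p + pow y p
  frobenius-additive {p@(suc (suc m))} p-prime p≡0 x y = begin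
    pow (x + y) p                                       ≡⟨ pow≡^ (x + y) p ⟩
    (x + y) ^ᴷ p                                        ≡⟨ BinomialTheorem.theorem p x y ⟩
    term 0 + sum {p} (λ i → term (toℕ (Fin.suc {p} i))) ≡⟨ cong (term 0 +_) (sum-init-last {suc m} (λ i → term (toℕ (Fin.suc {p} i)))) ⟩
    term 0 + (sum {suc m} middle + term (suc (toℕ (Fin.fromℕ (suc m)))))
                                                    ≡⟨ cong₂ (λ a b → term 0 + (a + b)) middle≡0 (cong (term ∘ suc) (toℕ-fromℕ (suc m))) ⟩
    term 0 + (0# + term p) ≡⟨ solve 2 (λ a b → a :+ (con (ℤ.+ 0) :+ b) := b :+ a) refl (term 0) (term p) ⟩
    term p + term 0        ≡⟨ cong₂ _+_ term-p term-0 ⟩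
    pow x p + pow y p      ∎
    where
    binomial term : ℕ → Carrier
    binomial k = (x ^ᴷ k) * (y ^ᴷ (p ℕ.∸ k))
    term k = (p C k) ×ₙ binomial k
    middle : Fin (suc m) → Carrier
    middle i = term (suc (toℕ (Fin.inject₁ i)))
    middle≡0 : sum {suc m} middle ≡ 0#
    middle≡0 = trans (sum-cong-≗ {suc m} (λ i → p∣m⇒m×x≡0 p≡0 (binomial (suc (toℕ (Fin.inject₁ i)))) (p∣pCk p-prime (s≤s z≤n) (s≤s (k<1+m i)))))
                     (sum-replicate-zero (suc m))
      where
      k<1+m : ∀ (i : Fin (suc m)) → toℕ (Fin.inject₁ i) < suc m
      k<1+m i = subst (_< suc m) (sym (toℕ-inject₁ i)) (toℕ<n i)
    term-0 : term 0 ≡ pow y p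
    term-0 = trans (+-identityʳ _) (trans (*-identityˡ _) (sym (pow≡^ y p)))
    term-p : term p ≡ pow x p
    term-p = begin
      (p C p) ×ₙ ((x ^ᴷ p) * (y ^ᴷ (p ℕ.∸ p))) ≡⟨ cong₂ (λ c e → c ×ₙ ((x ^ᴷ p) * (y ^ᴷ e))) (nCn≡1 p) (ℕ.n∸n≡0 p) ⟩
      1 ×ₙ ((x ^ᴷ p) * 1#)                     ≡⟨ +-identityʳ _ ⟩
      (x ^ᴷ p) * 1#                            ≡⟨ *-identityʳ _ ⟩
      x ^ᴷ p                                   ≡⟨ pow≡^ x p ⟨
      pow x p                                  ∎

  -- Polynomials are little-endian coefficient lists.
  eval : List Carrier → Carrier → Carrier
  eval []       x = 0#
  eval (c ∷ cs) x = c + x * eval cs x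

  coeff : List Carrier → ℕ → Carrier
  coeff []       i       = 0#
  coeff (c ∷ cs) zero    = c
  coeff (c ∷ cs) (suc i) = coeff cs i

  monomial : Carrier → ℕ → List Carrier
  monomial c zero    = c ∷ []
  monomial c (suc e) = 0# ∷ monomial c e

  infixl 6 _⊕_
  _⊕_ : List Carrier → List Carrier → List Carrier
  []       ⊕ qs       = qs
  (a ∷ ps) ⊕ []       = a ∷ ps
  (a ∷ ps) ⊕ (b ∷ qs) = (a + b) ∷ (ps ⊕ qs)

  eval-monomial : ∀ c e x → eval (monomial c e) x ≡ c * pow x e
  eval-monomial c zero    x = trans (cong (c +_) (zeroʳ x)) (trans (+-identityʳ c) (sym (*-identityʳ c)))
  eval-monomial c (suc e) x = trans (+-identityˡ _) (trans (cong (x *_) (eval-monomial c e x))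
    (solve 3 (λ x c a → x :* (c :* a) := c :* (x :* a)) refl x c (pow x e)))

  eval-⊕ : ∀ ps qs x → eval (ps ⊕ qs) x ≡ eval ps x + eval qs x
  eval-⊕ []       qs       x = sym (+-identityˡ _)
  eval-⊕ (a ∷ ps) []       x = sym (+-identityʳ _)
  eval-⊕ (a ∷ ps) (b ∷ qs) x = trans (cong (λ z → (a + b) + x * z) (eval-⊕ ps qs x))
    (solve 5 (λ a b x u v → (a :+ b) :+ x :* (u :+ v) := (a :+ x :* u) :+ (b :+ x :* v)) refl a b x (eval ps x) (eval qs x))

  coeff-⊕ : ∀ ps qs i → coeff (ps ⊕ qs) i ≡ coeff ps i + coeff qs i
  coeff-⊕ []       qs       i       = sym (+-identityˡ _)
  coeff-⊕ (a ∷ ps) []       zero    = sym (+-identityʳ _)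
  coeff-⊕ (a ∷ ps) []       (suc i) = sym (+-identityʳ _)
  coeff-⊕ (a ∷ ps) (b ∷ qs) zero    = refl
  coeff-⊕ (a ∷ ps) (b ∷ qs) (suc i) = coeff-⊕ ps qs i

  coeff-monomial-≡ : ∀ c e → coeff (monomial c e) e ≡ c
  coeff-monomial-≡ c zero    = refl
  coeff-monomial-≡ c (suc e) = coeff-monomial-≡ c e

  coeff-monomial-≢ : ∀ c e i → i ≢ e → coeff (monomial c e) i ≡ 0#
  coeff-monomial-≢ c zero    zero    i≢e = contradiction refl i≢e
  coeff-monomial-≢ c zero    (suc i) i≢e = refl
  coeff-monomial-≢ c (suc e) zero    i≢e = refl
  coeff-monomial-≢ c (suc e) (suc i) i≢e = coeff-monomial-≢ c e i (i≢e ∘ cong suc)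

  coeff-beyond-length : ∀ ps i → length ps ≤ i → coeff ps i ≡ 0#
  coeff-beyond-length []       i       _         = refl
  coeff-beyond-length (c ∷ cs) (suc i) (s≤s len≤) = coeff-beyond-length cs i len≤

  length-monomial : ∀ c e → length (monomial c e) ≡ suc e
  length-monomial c zero    = refl
  length-monomial c (suc e) = cong suc (length-monomial c e)

  length-⊕ : ∀ ps qs → length (ps ⊕ qs) ≡ length ps ⊔ length qs
  length-⊕ []       qs       = refl
  length-⊕ (a ∷ ps) []       = refl
  length-⊕ (a ∷ ps) (b ∷ qs) = cong suc (length-⊕ ps qs)

  private
    quotient : Carrier → List Carrier → List Carrier
    quotient r []       = []
    quotient r (d ∷ ds) = eval (d ∷ ds) r ∷ quotient r ds

    length-quotient : ∀ r cs → length (quotient r cs) ≡ length cs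
    length-quotient r []       = refl
    length-quotient r (d ∷ ds) = cong suc (length-quotient r ds)

    eval-quotient : ∀ r cs x → x * eval cs x - r * eval cs r ≡ (x - r) * eval (quotient r cs) x
    eval-quotient r []       x = solve 3 (λ x r z → x :* z :- r :* z := (x :- r) :* z) refl x r 0#
    eval-quotient r (d ∷ ds) x = begin
      x * (d + x * eval ds x) - r * (d + r * eval ds r)
        ≡⟨ solve 5 (λ x r d e f → x :* (d :+ x :* e) :- r :* (d :+ r :* f) := (x :- r) :* (d :+ r :* f) :+ x :* (x :* e :- r :* f)) refl x r d (eval ds x) (eval ds r) ⟩
      (x - r) * (d + r * eval ds r) + x * (x * eval ds x - r * eval ds r)
        ≡⟨ cong (λ z → (x - r) * (d + r * eval ds r) + x * z) (eval-quotient r ds x) ⟩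
      (x - r) * (d + r * eval ds r) + x * ((x - r) * eval (quotient r ds) x)
        ≡⟨ solve 4 (λ a b x c → a :* b :+ x :* (a :* c) := a :* (b :+ x :* c)) refl (x - r) (d + r * eval ds r) x (eval (quotient r ds) x) ⟩
      (x - r) * eval (quotient r (d ∷ ds)) x ∎

    eval-zero : ∀ cs x → All (_≡ 0#) cs → eval cs x ≡ 0#
    eval-zero []       x _           = refl
    eval-zero (c ∷ cs) x (c≡0 ∷ cs≡0) = begin
      c + x * eval cs x ≡⟨ cong₂ (λ a b → a + x * b) c≡0 (eval-zero cs x cs≡0) ⟩
      0# + x * 0#       ≡⟨ trans (+-identityˡ _) (zeroʳ x) ⟩
      0#                ∎

    head≡0 : ∀ {c} cs r → All (_≡ 0#) cs → eval (c ∷ cs) r ≡ 0# → c ≡ 0#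
    head≡0 {c} cs r cs≡0 eval≡0 = begin
      c               ≡⟨ +-identityʳ c ⟨
      c + 0#          ≡⟨ cong (c +_) (zeroʳ r) ⟨
      c + r * 0#      ≡⟨ cong (λ z → c + r * z) (eval-zero cs r cs≡0) ⟨
      eval (c ∷ cs) r ≡⟨ eval≡0 ⟩
      0#              ∎

    quotient-zero : ∀ r cs → All (_≡ 0#) (quotient r cs) → All (_≡ 0#) cs
    quotient-zero r []       _            = []
    quotient-zero r (d ∷ ds) (e≡0 ∷ q≡0) = head≡0 ds r ds≡0 e≡0 ∷ ds≡0
      where
      ds≡0 : All (_≡ 0#) ds
      ds≡0 = quotient-zero r ds q≡0

  vanishing⇒zero : ∀ cs xs → Unique xs → All (λ x → eval cs x ≡ 0#) xs → length cs ≤ length xs → All (_≡ 0#) cs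
  vanishing⇒zero []       xs       _           _                  _          = []
  vanishing⇒zero (c ∷ cs) (r ∷ rs) (r∉rs ∷ u) (root-r ∷ roots-rs) (s≤s len≤) = head≡0 cs r cs≡0 root-r ∷ cs≡0
    where
    quotient-roots : All (λ x → eval (quotient r cs) x ≡ 0#) rs
    quotient-roots = All.tabulate λ {s} s∈rs →
      case x*y≡0⇒x≡0∨y≡0 (trans (sym (eval-quotient r cs s)) (begin
        s * eval cs s - r * eval cs r     ≡⟨ solve 5 (λ c s r a b → s :* a :- r :* b := (c :+ s :* a) :- (c :+ r :* b)) refl c s r (eval cs s) (eval cs r) ⟩
        eval (c ∷ cs) s - eval (c ∷ cs) r ≡⟨ cong₂ _-_ (All.lookup roots-rs s∈rs) root-r ⟩
        0# - 0#                           ≡⟨ -‿inverseʳ 0# ⟩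
        0#                                         ∎)) of λ
        { (inj₁ s-r≡0) → contradiction (sym (x-y≡0⇒x≡y s-r≡0)) (All.lookup r∉rs s∈rs)
        ; (inj₂ q≡0)   → q≡0 }
    cs≡0 : All (_≡ 0#) cs
    cs≡0 = quotient-zero r cs (vanishing⇒zero (quotient r cs) rs u quotient-roots
             (subst (_≤ length rs) (sym (length-quotient r cs)) len≤))

  #roots<length : ∀ cs i → coeff cs i ≢ 0# → count (λ x → eval cs x ≟ 0#) < length cs
  #roots<length cs i cᵢ≢0 with count (λ x → eval cs x ≟ 0#) ℕ.<? length cs
  ... | yes #roots<length = #roots<length
  ... | no  #roots≮length = contradiction (coeff-zero cs i (vanishing⇒zero cs roots
          (Unique.filter⁺ (λ x → eval cs x ≟ 0#) unique)
          (All.tabulate λ x∈ → proj₂ (∈-filter⁻ (λ x → eval cs x ≟ 0#) {xs = elems} x∈))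
          (ℕ.≮⇒≥ #roots≮length))) cᵢ≢0
    where
    roots : List Carrier
    roots = filter (λ x → eval cs x ≟ 0#) elems
    coeff-zero : ∀ cs i → All (_≡ 0#) cs → coeff cs i ≡ 0#
    coeff-zero []       i       _            = refl
    coeff-zero (c ∷ cs) zero    (c≡0 ∷ _)    = c≡0
    coeff-zero (c ∷ cs) (suc i) (_ ∷ cs≡0)   = coeff-zero cs i cs≡0

  IsAdditive : (Carrier → Carrier) → Set
  IsAdditive f = ∀ x y → f (x + y) ≡ f x + f y

  module AdditiveMap {f : Carrier → Carrier} (f-additive : IsAdditive f) where

    f-0 : f 0# ≡ 0#
    f-0 = x+y≡y⇒x≡0 (trans (sym (f-additive 0# 0#)) (cong f (+-identityʳ 0#)))

    f-neg : ∀ x → f (- x) ≡ - f x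
    f-neg x = begin
      f (- x)               ≡⟨ solve 2 (λ a b → a := (b :+ a) :- b) refl (f (- x)) (f x) ⟩
      (f x + f (- x)) - f x ≡⟨ cong (_- f x) (f-additive x (- x)) ⟨
      f (x - x) - f x       ≡⟨ cong (λ z → f z - f x) (-‿inverseʳ x) ⟩
      f 0# - f x            ≡⟨ cong (_- f x) f-0 ⟩
      0# - f x              ≡⟨ +-identityˡ _ ⟩
      - f x                 ∎

    f-sub : ∀ x y → f (x - y) ≡ f x - f y
    f-sub x y = trans (f-additive x (- y)) (cong (f x +_) (f-neg y))

    Image : Pred Carrier 0ℓ
    Image y = Any (λ x → f x ≡ y) elems

    Image? : Decidable Image
    Image? y = any? (λ x → f x ≟ y) elems

    Kernel? : Decidable (λ x → f x ≡ 0#)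
    Kernel? x = f x ≟ 0#

    #ker #im : ℕ
    #ker = count Kernel?
    #im  = count Image?

    f∈Image : ∀ x → Image (f x)
    f∈Image x = Any.map (λ x≡y → cong f (sym x≡y)) (complete x)

    private
      section : Carrier → Carrier
      section y with Image? y
      ... | yes y∈im = proj₁ (Any.satisfied y∈im)
      ... | no _     = 0#

      f∘section : ∀ {y} → Image y → f (section y) ≡ y
      f∘section {y} y∈im with Image? y
      ... | yes y∈im′ = proj₂ (Any.satisfied y∈im′)
      ... | no  y∉im  = contradiction y∈im y∉im

    -- x ↦ (x − section (f x), f x) maps the preimage of S bijectively onto ker f × (S ∩ im f).
    #preimage : ∀ {S : Pred Carrier 0ℓ} (S? : Decidable S) → count (S? ∘ f) ≡ #ker ℕ.* count (S? ∩? Image?)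
    #preimage {S} S? = trans (ℕ.≤-antisym (count-≤-injection enumeration enumeration² (S? ∘ f) KS? split split-maps split-injective)
                                           (count-≤-injection enumeration² enumeration KS? (S? ∘ f) join join-maps join-injective))
                             (count-× enumeration enumeration Kernel? (S? ∩? Image?))
      where
      enumeration² : Enumeration (Carrier × Carrier)
      enumeration² = enumeration ×ᴱ enumeration
      KS? : Decidable (λ (k , y) → f k ≡ 0# × S y × Image y)
      KS? = Kernel? ×? (S? ∩? Image?)
      split : Carrier → Carrier × Carrier
      split x = x - section (f x) , f x
      split-maps : ∀ {x} → S (f x) → f (x - section (f x)) ≡ 0# × S (f x) × Image (f x)
      split-maps {x} Sfx = trans (f-sub x _) (trans (cong (λ z → f x - z) (f∘section (f∈Image x))) (-‿inverseʳ (f x))) , Sfx , f∈Image x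
      split-injective : ∀ {x y} → S (f x) → S (f y) → split x ≡ split y → x ≡ y
      split-injective {x} {y} _ _ eq = begin
        x                                   ≡⟨ solve 2 (λ x s → x := (x :- s) :+ s) refl x (section (f x)) ⟩
        (x - section (f x)) + section (f x) ≡⟨ cong₂ (λ a b → a + section b) (cong proj₁ eq) (cong proj₂ eq) ⟩
        (y - section (f y)) + section (f y) ≡⟨ solve 2 (λ y s → (y :- s) :+ s := y) refl y (section (f y)) ⟩
        y                                   ∎
      join : Carrier × Carrier → Carrier
      join (k , y) = k + section y
      f∘join : ∀ {k y} → f k ≡ 0# → Image y → f (join (k , y)) ≡ y
      f∘join {k} {y} fk≡0 y∈im = trans (f-additive k (section y)) (trans (cong₂ _+_ fk≡0 (f∘section y∈im)) (+-identityˡ y))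
      join-maps : ∀ {ky} → (f (proj₁ ky) ≡ 0# × S (proj₂ ky) × Image (proj₂ ky)) → S (f (join ky))
      join-maps (fk≡0 , Sy , y∈im) = subst S (sym (f∘join fk≡0 y∈im)) Sy
      join-injective : ∀ {ky ky′} → (f (proj₁ ky) ≡ 0# × S (proj₂ ky) × Image (proj₂ ky)) →
                        (f (proj₁ ky′) ≡ 0# × S (proj₂ ky′) × Image (proj₂ ky′)) → join ky ≡ join ky′ → ky ≡ ky′
      join-injective {k , y} {k′ , y′} (fk≡0 , _ , y∈im) (fk′≡0 , _ , y′∈im) eq = cong₂ _,_ k≡k′ y≡y′
        where
        y≡y′ : y ≡ y′
        y≡y′ = trans (sym (f∘join fk≡0 y∈im)) (trans (cong f eq) (f∘join fk′≡0 y′∈im))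
        k≡k′ : k ≡ k′
        k≡k′ = begin
          k                              ≡⟨ solve 2 (λ k s → k := (k :+ s) :- s) refl k (section y) ⟩
          (k + section y) - section y    ≡⟨ cong₂ (λ a b → a - section b) eq y≡y′ ⟩
          (k′ + section y′) - section y′ ≡⟨ solve 2 (λ k s → (k :+ s) :- s := k) refl k′ (section y′) ⟩
          k′                             ∎

    rank-nullity : card ≡ #ker ℕ.* #im
    rank-nullity = begin
      card                                      ≡⟨ count-all ⟨
      count {λ _ → ⊤} (λ _ → yes tt)            ≡⟨ #preimage {λ _ → ⊤} (λ _ → yes tt) ⟩
      #ker ℕ.* count ((λ _ → yes tt) ∩? Image?) ≡⟨ cong (#ker ℕ.*_) (count-cong enumeration _ Image? proj₂ (tt ,_)) ⟩
      #ker ℕ.* #im                              ∎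

    #distinct-values≡#im : length (deduplicate _≟_ (map f elems)) ≡ #im
    #distinct-values≡#im = ↭-length (↭-of-same-elements (deduplicate-! _≟_ (map f elems)) (Unique.filter⁺ Image? unique) to from)
      where
      to : ∀ {y} → y ∈ deduplicate _≟_ (map f elems) → y ∈ filter Image? elems
      to {y} y∈ with ∈-map⁻ f (Equivalence.from (deduplicate-∈⇔ _≟_) y∈)
      ... | x , _ , refl = ∈-filter⁺ Image? (complete (f x)) (f∈Image x)
      from : ∀ {y} → y ∈ filter Image? elems → y ∈ deduplicate _≟_ (map f elems)
      from {y} y∈ with Any.satisfied (proj₂ (∈-filter⁻ Image? {xs = elems} y∈))
      ... | x , refl = Equivalence.to (deduplicate-∈⇔ _≟_) (∈-map⁺ f (complete x))

  Σ<-cong : ∀ m {f g : ℕ → Carrier} → (∀ i → f i ≡ g i) → Σ< m f ≡ Σ< m g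
  Σ<-cong zero    f≗g = refl
  Σ<-cong (suc m) f≗g = cong₂ _+_ (Σ<-cong m f≗g) (f≗g m)

  Σ<-+ : ∀ m (f g : ℕ → Carrier) → Σ< m (λ i → f i + g i) ≡ Σ< m f + Σ< m g
  Σ<-+ zero    f g = sym (+-identityʳ 0#)
  Σ<-+ (suc m) f g = trans (cong (_+ (f m + g m)) (Σ<-+ m f g))
    (solve 4 (λ a b c d → (a :+ b) :+ (c :+ d) := (a :+ c) :+ (b :+ d)) refl (Σ< m f) (Σ< m g) (f m) (g m))

  Σ<-*ˡ : ∀ m c (f : ℕ → Carrier) → Σ< m (λ i → c * f i) ≡ c * Σ< m f
  Σ<-*ˡ zero    c f = sym (zeroʳ c)
  Σ<-*ˡ (suc m) c f = trans (cong (_+ c * f m) (Σ<-*ˡ m c f)) (sym (distribˡ c (Σ< m f) (f m)))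

  Σ<-telescope : ∀ m (f : ℕ → Carrier) → Σ< m (λ i → f (suc i) - f i) ≡ f m - f 0
  Σ<-telescope zero    f = sym (-‿inverseʳ (f 0))
  Σ<-telescope (suc m) f = trans (cong (_+ (f (suc m) - f m)) (Σ<-telescope m f))
    (solve 3 (λ a b c → (b :- a) :+ (c :- b) := c :- a) refl (f 0) (f m) (f (suc m)))


module Extension (K : FiniteField) {p k q n : ℕ} (p-prime : Prime p) (1≤k : 1 ≤ k) (q≡pᵏ : q ≡ p ℕ.^ k)
                 (0<n : 0 < n) (card≡qⁿ : FiniteField.card K ≡ q ℕ.^ n) where
  open FieldTheory K

  instance
    n≢0 : NonZero n
    n≢0 = ℕ.>-nonZero 0<n

  1<q : 1 < q
  1<q = subst (1 <_) (sym q≡pᵏ) (1<p^ k 1≤k)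
    where
    1<p : 1 < p
    1<p = ℕ.nonTrivial⇒n>1 p {{prime⇒nonTrivial p-prime}}
    1<p^ : ∀ j → 1 ≤ j → 1 < p ℕ.^ j
    1<p^ (suc zero)    _ = subst (1 <_) (sym (ℕ.*-identityʳ p)) 1<p
    1<p^ (suc (suc j)) _ = ℕ.<-≤-trans (1<p^ (suc j) (s≤s z≤n)) (ℕ.m≤n*m _ p {{ℕ.>-nonZero (ℕ.<-trans ℕ.z<s 1<p)}})

  instance
    q≢0 : NonZero q
    q≢0 = ℕ.>-nonZero (ℕ.<-trans ℕ.z<s 1<q)

  q^-mono-< : ∀ {a b} → a < b → q ℕ.^ a < q ℕ.^ b
  q^-mono-< = ℕ.^-monoʳ-< q 1<q

  q^-mono-≤ : ∀ {a b} → a ≤ b → q ℕ.^ a ≤ q ℕ.^ b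
  q^-mono-≤ = ℕ.^-monoʳ-≤ q

  q^-cancel-≤ : ∀ {a b} → q ℕ.^ a ≤ q ℕ.^ b → a ≤ b
  q^-cancel-≤ qᵃ≤qᵇ = ℕ.≮⇒≥ (λ b<a → ℕ.<⇒≱ (q^-mono-< b<a) qᵃ≤qᵇ)

  q^-injective : ∀ {a b} → q ℕ.^ a ≡ q ℕ.^ b → a ≡ b
  q^-injective qᵃ≡qᵇ = ℕ.≤-antisym (q^-cancel-≤ (ℕ.≤-reflexive qᵃ≡qᵇ)) (q^-cancel-≤ (ℕ.≤-reflexive (sym qᵃ≡qᵇ)))

  1+q^m≤q^[1+m] : ∀ m → suc (q ℕ.^ m) ≤ q ℕ.^ suc m
  1+q^m≤q^[1+m] m = q^-mono-< {m} {suc m} ℕ.≤-refl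

  card≡q*q^pred-n : card ≡ q ℕ.* q ℕ.^ pred n
  card≡q*q^pred-n = trans card≡qⁿ (cong (q ℕ.^_) (sym (ℕ.suc-pred n)))

  Fr : ℕ → Carrier → Carrier
  Fr i = frob K q n i

  private
    IsAdditivePower : ℕ → Set
    IsAdditivePower e = ∀ x y → pow (x + y) e ≡ pow x e + pow y e

    additivePower-* : ∀ a b → IsAdditivePower a → IsAdditivePower b → IsAdditivePower (b ℕ.* a)
    additivePower-* a b a-additive b-additive x y = begin
      pow (x + y) (b ℕ.* a)             ≡⟨ pow-assocʳ (x + y) b a ⟨
      pow (pow (x + y) b) a             ≡⟨ cong (λ z → pow z a) (b-additive x y) ⟩
      pow (pow x b + pow y b) a         ≡⟨ a-additive _ _ ⟩
      pow (pow x b) a + pow (pow y b) a ≡⟨ cong₂ _+_ (pow-assocʳ x b a) (pow-assocʳ y b a) ⟩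
      pow x (b ℕ.* a) + pow y (b ℕ.* a) ∎
      where open ≡-Reasoning

    additivePower-^ : ∀ a → IsAdditivePower a → ∀ j → IsAdditivePower (a ℕ.^ j)
    additivePower-^ a a-additive zero    x y = trans (*-identityʳ _) (sym (cong₂ _+_ (*-identityʳ x) (*-identityʳ y)))
    additivePower-^ a a-additive (suc j) = additivePower-* (a ℕ.^ j) a (additivePower-^ a a-additive j) a-additive

    p×1≡0 : p ×ₙ 1# ≡ 0#
    p×1≡0 = characteristic p (k ℕ.* n) (ℕ.*-mono-≤ 1≤k (ℕ.>-nonZero⁻¹ n))
      (trans card≡qⁿ (trans (cong (ℕ._^ n) q≡pᵏ) (ℕ.^-*-assoc p k n)))

  Fr-additive : ∀ i → IsAdditive (Fr i)
  Fr-additive i = additivePower-^ q (subst IsAdditivePower (sym q≡pᵏ) (additivePower-^ p (frobenius-additive p-prime p×1≡0) k)) i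

  module Fr i = AdditiveMap (Fr-additive i)

  Fr-* : ∀ i x y → Fr i (x * y) ≡ Fr i x * Fr i y
  Fr-* i x y = pow-distrib-* x y (q ℕ.^ i)

  Fr-1# : ∀ i → Fr i 1# ≡ 1#
  Fr-1# i = pow-1# (q ℕ.^ i)

  Fr-zero : ∀ x → Fr 0 x ≡ x
  Fr-zero = *-identityʳ

  Fr-suc : ∀ i x → Fr i (Fr 1 x) ≡ Fr (suc i) x
  Fr-suc i x = trans (pow-assocʳ x (q ℕ.^ 1) (q ℕ.^ i))
    (cong (λ e → pow x (e ℕ.* q ℕ.^ i)) (ℕ.*-identityʳ q))

  Fr-n : ∀ x → Fr n x ≡ x
  Fr-n x = trans (cong (pow x) (sym card≡qⁿ)) (fermat x)

  IsFq : Pred Carrier 0ℓ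
  IsFq c = Fr 1 c ≡ c

  IsFq? : Decidable IsFq
  IsFq? c = Fr 1 c ≟ c

  IsFq⇒Fr-fixed : ∀ {c} → IsFq c → ∀ i → Fr i c ≡ c
  IsFq⇒Fr-fixed {c} c∈Fq zero    = Fr-zero c
  IsFq⇒Fr-fixed {c} c∈Fq (suc i) = trans (sym (Fr-suc i c)) (trans (cong (Fr i) c∈Fq) (IsFq⇒Fr-fixed c∈Fq i))

  Fq-1# : IsFq 1#
  Fq-1# = Fr-1# 1

  Fq-* : ∀ {a b} → IsFq a → IsFq b → IsFq (a * b)
  Fq-* {a} {b} a∈Fq b∈Fq = trans (Fr-* 1 a b) (cong₂ _*_ a∈Fq b∈Fq)

  Fq-- : ∀ {a b} → IsFq a → IsFq b → IsFq (a - b)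
  Fq-- {a} {b} a∈Fq b∈Fq = trans (Fr.f-sub 1 a b) (cong₂ _-_ a∈Fq b∈Fq)

  Fq-inv : ∀ {a} (a≢0 : a ≢ 0#) → IsFq a → IsFq (inv a a≢0)
  Fq-inv {a} a≢0 a∈Fq = *-cancelˡ a≢0 (begin
    a * Fr 1 (inv a a≢0)      ≡⟨ cong (_* Fr 1 (inv a a≢0)) a∈Fq ⟨
    Fr 1 a * Fr 1 (inv a a≢0) ≡⟨ Fr-* 1 a (inv a a≢0) ⟨
    Fr 1 (a * inv a a≢0)      ≡⟨ cong (Fr 1) (x*inv≡1 a a≢0) ⟩
    Fr 1 1#                   ≡⟨ Fr-1# 1 ⟩
    1#                        ≡⟨ x*inv≡1 a a≢0 ⟨
    a * inv a a≢0             ∎)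
    where open ≡-Reasoning

  IsFqLinear : (Carrier → Carrier) → Set
  IsFqLinear f = ∀ {a b} → IsFq a → IsFq b → ∀ x y → f (a * x + b * y) ≡ a * f x + b * f y

  linear⇒additive : ∀ {f} → IsFqLinear f → IsAdditive f
  linear⇒additive {f} f-linear x y = begin
    f (x + y)           ≡⟨ cong f (cong₂ _+_ (*-identityˡ x) (*-identityˡ y)) ⟨
    f (1# * x + 1# * y) ≡⟨ f-linear Fq-1# Fq-1# x y ⟩
    1# * f x + 1# * f y ≡⟨ cong₂ _+_ (*-identityˡ (f x)) (*-identityˡ (f y)) ⟩
    f x + f y           ∎
    where open ≡-Reasoning

  linearized : ℕ → (ℕ → Carrier) → Carrier → Carrier
  linearized m c x = Σ< m (λ i → c i * Fr i x)

  linearized-linear : ∀ m c → IsFqLinear (linearized m c)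
  linearized-linear m c {a} {b} a∈Fq b∈Fq x y = begin
    Σ< m (λ i → c i * Fr i (a * x + b * y))                           ≡⟨ Σ<-cong m term ⟩
    Σ< m (λ i → a * (c i * Fr i x) + b * (c i * Fr i y))              ≡⟨ Σ<-+ m _ _ ⟩
    Σ< m (λ i → a * (c i * Fr i x)) + Σ< m (λ i → b * (c i * Fr i y)) ≡⟨ cong₂ _+_ (Σ<-*ˡ m a _) (Σ<-*ˡ m b _) ⟩
    a * linearized m c x + b * linearized m c y                       ∎
    where
    open ≡-Reasoning
    term : ∀ i → c i * Fr i (a * x + b * y) ≡ a * (c i * Fr i x) + b * (c i * Fr i y)
    term i = begin
      c i * Fr i (a * x + b * y)                ≡⟨ cong (c i *_) (Fr-additive i (a * x) (b * y)) ⟩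
      c i * (Fr i (a * x) + Fr i (b * y))       ≡⟨ cong₂ (λ u v → c i * (u + v)) (Fr-* i a x) (Fr-* i b y) ⟩
      c i * (Fr i a * Fr i x + Fr i b * Fr i y) ≡⟨ cong₂ (λ u v → c i * (u * Fr i x + v * Fr i y)) (IsFq⇒Fr-fixed a∈Fq i) (IsFq⇒Fr-fixed b∈Fq i) ⟩
      c i * (a * Fr i x + b * Fr i y)           ≡⟨ solve 5 (λ c a b u v → c :* (a :* u :+ b :* v) := a :* (c :* u) :+ b :* (c :* v)) refl (c i) a b (Fr i x) (Fr i y) ⟩
      a * (c i * Fr i x) + b * (c i * Fr i y)   ∎

  private
    linearizedPoly : ℕ → (ℕ → Carrier) → List Carrier
    linearizedPoly zero    c = []
    linearizedPoly (suc m) c = linearizedPoly m c ⊕ monomial (c m) (q ℕ.^ m)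

    eval-linearizedPoly : ∀ m c x → eval (linearizedPoly m c) x ≡ linearized m c x
    eval-linearizedPoly zero    c x = refl
    eval-linearizedPoly (suc m) c x = trans (eval-⊕ (linearizedPoly m c) _ x)
      (cong₂ _+_ (eval-linearizedPoly m c x) (eval-monomial (c m) (q ℕ.^ m) x))

    length-linearizedPoly : ∀ m c → length (linearizedPoly m c) ≤ q ℕ.^ m
    length-linearizedPoly-suc : ∀ m c → length (linearizedPoly (suc m) c) ≤ suc (q ℕ.^ m)

    length-linearizedPoly zero    c = z≤n
    length-linearizedPoly (suc m) c = ℕ.≤-trans (length-linearizedPoly-suc m c) (1+q^m≤q^[1+m] m)

    length-linearizedPoly-suc m c =
      subst (_≤ suc (q ℕ.^ m)) (sym (trans (length-⊕ (linearizedPoly m c) _) (cong (length (linearizedPoly m c) ⊔_) (length-monomial (c m) (q ℕ.^ m)))))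
            (ℕ.⊔-lub (ℕ.≤-trans (length-linearizedPoly m c) (ℕ.n≤1+n _)) ℕ.≤-refl)

    coeff-linearizedPoly : ∀ m c j → j < m → coeff (linearizedPoly m c) (q ℕ.^ j) ≡ c j
    coeff-linearizedPoly (suc m) c j j<1+m with j ℕ.≟ m
    ... | yes refl = trans (coeff-⊕ (linearizedPoly m c) _ (q ℕ.^ j))
      (trans (cong₂ _+_ (coeff-beyond-length (linearizedPoly m c) (q ℕ.^ m) (length-linearizedPoly m c)) (coeff-monomial-≡ (c m) (q ℕ.^ m))) (+-identityˡ _))
    ... | no j≢m = trans (coeff-⊕ (linearizedPoly m c) _ (q ℕ.^ j))
      (trans (cong₂ _+_ (coeff-linearizedPoly m c j (ℕ.≤∧≢⇒< (ℕ.s≤s⁻¹ j<1+m) j≢m))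
                        (coeff-monomial-≢ (c m) _ _ (j≢m ∘ q^-injective))) (+-identityʳ _))

  ≗linearized⇒linear : ∀ {f : Carrier → Carrier} m c → (∀ x → f x ≡ linearized m c x) → IsFqLinear f
  ≗linearized⇒linear {f} m c f≗L {a} {b} a∈Fq b∈Fq x y = begin
    f (a * x + b * y)                           ≡⟨ f≗L _ ⟩
    linearized m c (a * x + b * y)              ≡⟨ linearized-linear m c a∈Fq b∈Fq x y ⟩
    a * linearized m c x + b * linearized m c y ≡⟨ cong₂ (λ u v → a * u + b * v) (f≗L x) (f≗L y) ⟨
    a * f x + b * f y                           ∎
    where open ≡-Reasoning

  ≗linearized⇒#roots≤ : ∀ (f : Carrier → Carrier) m c {j} → (∀ x → f x ≡ linearized (suc m) c x) → j ≤ m → c j ≢ 0# →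
                        count (λ x → f x ≟ 0#) ≤ q ℕ.^ m
  ≗linearized⇒#roots≤ f m c {j} f≗L j≤m cⱼ≢0 = ℕ.s≤s⁻¹ (begin-strict
    count (λ x → f x ≟ 0#)                                 ≡⟨ count-cong enumeration _ _ (λ fx≡0 → trans (eval-linearizedPoly (suc m) c _) (trans (sym (f≗L _)) fx≡0))
                                                                                   (λ P≡0 → trans (f≗L _) (trans (sym (eval-linearizedPoly (suc m) c _)) P≡0)) ⟩
    count (λ x → eval (linearizedPoly (suc m) c) x ≟ 0#) <⟨ #roots<length (linearizedPoly (suc m) c) (q ℕ.^ j) (cⱼ≢0 ∘ trans (sym (coeff-linearizedPoly (suc m) c j (s≤s j≤m)))) ⟩
    length (linearizedPoly (suc m) c)                    ≤⟨ length-linearizedPoly-suc m c ⟩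
    suc (q ℕ.^ m)                                        ∎)
    where open ℕ.≤-Reasoning

  Trace : Carrier → Carrier
  Trace = Tr K q n

  Trace≡linearized : ∀ y → Trace y ≡ linearized n (λ _ → 1#) y
  Trace≡linearized y = Σ<-cong n (λ i → sym (*-identityˡ (Fr i y)))

  Trace-linear : IsFqLinear Trace
  Trace-linear = ≗linearized⇒linear n _ Trace≡linearized

  #ker-Trace≤ : count (λ y → Trace y ≟ 0#) ≤ q ℕ.^ pred n
  #ker-Trace≤ = ≗linearized⇒#roots≤ Trace (pred n) (λ _ → 1#) (λ y → trans (Trace≡linearized y) (cong (λ m → linearized m _ y) (sym (ℕ.suc-pred n)))) z≤n 1≢0

  φ : Carrier → Carrier
  φ x = Fr 1 x - x

  φ≡linearized : ∀ x → φ x ≡ linearized 2 (coeff (- 1# ∷ 1# ∷ [])) x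
  φ≡linearized x = begin
    Fr 1 x - x                           ≡⟨ cong (λ z → Fr 1 x - z) (Fr-zero x) ⟨
    Fr 1 x - Fr 0 x                      ≡⟨ solve 2 (λ u v → u :- v := (con (ℤ.+ 0) :+ (:- con (ℤ.+ 1)) :* v) :+ con (ℤ.+ 1) :* u) refl (Fr 1 x) (Fr 0 x) ⟩
    (0# + (- 1#) * Fr 0 x) + 1# * Fr 1 x ∎
    where open ≡-Reasoning

  φ-linear : IsFqLinear φ
  φ-linear = ≗linearized⇒linear 2 (coeff (- 1# ∷ 1# ∷ [])) φ≡linearized

  module φ = AdditiveMap (linear⇒additive φ-linear)

  Trace∘φ≡0 : ∀ x → Trace (φ x) ≡ 0#
  Trace∘φ≡0 x = begin
    Σ< n (λ i → Fr i (Fr 1 x - x))     ≡⟨ Σ<-cong n (λ i → trans (Fr.f-sub i (Fr 1 x) x) (cong (_- Fr i x) (Fr-suc i x))) ⟩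
    Σ< n (λ i → Fr (suc i) x - Fr i x) ≡⟨ Σ<-telescope n (λ i → Fr i x) ⟩
    Fr n x - Fr 0 x                    ≡⟨ cong₂ _-_ (Fr-n x) (Fr-zero x) ⟩
    x - x                              ≡⟨ -‿inverseʳ x ⟩
    0#                                 ∎
    where open ≡-Reasoning

  im-φ⊆ker-Trace : ∀ {y} → φ.Image y → Trace y ≡ 0#
  im-φ⊆ker-Trace y∈im with Any.satisfied y∈im
  ... | x , refl = Trace∘φ≡0 x

  #Fq≤q : count IsFq? ≤ q
  #Fq≤q = begin
    count IsFq?            ≡⟨ count-cong enumeration _ _ x≡y⇒x-y≡0 x-y≡0⇒x≡y ⟩
    count (λ x → φ x ≟ 0#) ≤⟨ ≗linearized⇒#roots≤ φ 1 (coeff (- 1# ∷ 1# ∷ [])) φ≡linearized ℕ.≤-refl 1≢0 ⟩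
    q ℕ.^ 1                ≡⟨ ℕ.*-identityʳ q ⟩
    q                      ∎
    where open ℕ.≤-Reasoning

  #ker-φ≡#Fq : φ.#ker ≡ count IsFq?
  #ker-φ≡#Fq = count-cong enumeration _ _ x-y≡0⇒x≡y x≡y⇒x-y≡0

  #Fq≡q : count IsFq? ≡ q
  #Fq≡q = ℕ.≤-antisym #Fq≤q (ℕ.*-cancelʳ-≤ q (count IsFq?) (q ℕ.^ pred n) {{ℕ.m^n≢0 q (pred n)}} (begin
    q ℕ.* q ℕ.^ pred n           ≡⟨ card≡q*q^pred-n ⟨
    card                         ≡⟨ φ.rank-nullity ⟩
    φ.#ker ℕ.* φ.#im             ≤⟨ ℕ.*-mono-≤ (ℕ.≤-reflexive #ker-φ≡#Fq) #im-φ≤ ⟩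
    count IsFq? ℕ.* q ℕ.^ pred n ∎))
    where
    open ℕ.≤-Reasoning
    #im-φ≤ : φ.#im ≤ q ℕ.^ pred n
    #im-φ≤ = ℕ.≤-trans (count-mono enumeration φ.Image? _ im-φ⊆ker-Trace) #ker-Trace≤

  #ker-φ≡q : φ.#ker ≡ q
  #ker-φ≡q = trans #ker-φ≡#Fq #Fq≡q

  #im-φ≡q^pred-n : φ.#im ≡ q ℕ.^ pred n
  #im-φ≡q^pred-n = ℕ.*-cancelˡ-≡ φ.#im (q ℕ.^ pred n) q (begin
    q ℕ.* φ.#im        ≡⟨ cong (ℕ._* φ.#im) #ker-φ≡q ⟨
    φ.#ker ℕ.* φ.#im   ≡⟨ φ.rank-nullity ⟨
    card               ≡⟨ card≡q*q^pred-n ⟩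
    q ℕ.* q ℕ.^ pred n ∎)
    where open ≡-Reasoning

  ker-Trace⊆im-φ : ∀ {y} → Trace y ≡ 0# → φ.Image y
  ker-Trace⊆im-φ {y} Trace-y≡0 with φ.Image? y
  ... | yes y∈im = y∈im
  ... | no  y∉im = contradiction #ker-Trace≤ (ℕ.<⇒≱ (begin-strict
    q ℕ.^ pred n                                                         ≡⟨ trans (sym #im-φ≡q^pred-n) (count-cong enumeration _ _ (λ y∈im → im-φ⊆ker-Trace y∈im , y∈im) proj₂) ⟩
    count (ker-Trace? ∩? φ.Image?)                                       <⟨ ℕ.m<m+n _ (count-positive (ker-Trace? ∩? ∁? φ.Image?) (Trace-y≡0 , y∉im)) ⟩
    count (ker-Trace? ∩? φ.Image?) ℕ.+ count (ker-Trace? ∩? ∁? φ.Image?) ≡⟨ count-split ker-Trace? φ.Image? ⟨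
    count ker-Trace?                                                     ∎))
    where
    open ℕ.≤-Reasoning
    ker-Trace? : Decidable (λ y → Trace y ≡ 0#)
    ker-Trace? y = Trace y ≟ 0#

  IsFqSubspace : Pred Carrier 0ℓ → Set
  IsFqSubspace V = ∀ {a b x y} → IsFq a → IsFq b → V x → V y → V (a * x + b * y)

  kernel-subspace : ∀ f → IsFqLinear f → IsFqSubspace (λ x → f x ≡ 0#)
  kernel-subspace f f-linear {a} {b} {x} {y} a∈Fq b∈Fq fx≡0 fy≡0 = begin
    f (a * x + b * y) ≡⟨ f-linear a∈Fq b∈Fq x y ⟩
    a * f x + b * f y ≡⟨ cong₂ (λ u v → a * u + b * v) fx≡0 fy≡0 ⟩
    a * 0# + b * 0#   ≡⟨ cong₂ _+_ (zeroʳ a) (zeroʳ b) ⟩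
    0# + 0#           ≡⟨ +-identityʳ 0# ⟩
    0#                ∎
    where open ≡-Reasoning

  ∩-subspace : ∀ {V W} → IsFqSubspace V → IsFqSubspace W → IsFqSubspace (V ∩ W)
  ∩-subspace V-subspace W-subspace a∈Fq b∈Fq (x∈V , x∈W) (y∈V , y∈W) =
    V-subspace a∈Fq b∈Fq x∈V y∈V , W-subspace a∈Fq b∈Fq x∈W y∈W

  #Fq-multiples≤q : ∀ {y} (y≢0 : y ≢ 0#) → count (λ z → IsFq? (z * inv y y≢0)) ≤ q
  #Fq-multiples≤q {y} y≢0 = subst (count (λ z → IsFq? (z * inv y y≢0)) ≤_) #Fq≡q
    (count-≤-injection enumeration enumeration _ IsFq? (_* inv y y≢0) (λ z∈ → z∈) (λ _ _ → *-cancelʳ (inv≢0 y y≢0)))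

  independent⇒span-injective : ∀ {y₁ y₂} (y₁≢0 : y₁ ≢ 0#) → ¬ IsFq (y₂ * inv y₁ y₁≢0) →
    ∀ {a b a′ b′} → IsFq a → IsFq b → IsFq a′ → IsFq b′ → a * y₁ + b * y₂ ≡ a′ * y₁ + b′ * y₂ → (a , b) ≡ (a′ , b′)
  independent⇒span-injective {y₁} {y₂} y₁≢0 y₂∉Fq·y₁ {a} {b} {a′} {b′} a∈Fq b∈Fq a′∈Fq b′∈Fq eq with b ≟ b′
  ... | yes refl = cong (_, b) (*-cancelʳ y₁≢0 (+-cancelʳ (b * y₂) _ _ eq))
  ... | no b≢b′  = contradiction (subst IsFq (sym y₂/y₁≡) (Fq-* (Fq-inv d≢0 (Fq-- b′∈Fq b∈Fq)) (Fq-- a∈Fq a′∈Fq))) y₂∉Fq·y₁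
    where
    open ≡-Reasoning
    d : Carrier
    d = b′ - b
    d≢0 : d ≢ 0#
    d≢0 d≡0 = b≢b′ (sym (x-y≡0⇒x≡y d≡0))
    [a-a′]y₁≡dy₂ : (a - a′) * y₁ ≡ d * y₂
    [a-a′]y₁≡dy₂ = begin
      (a - a′) * y₁                            ≡⟨ solve 4 (λ a a′ y z → (a :- a′) :* y := (a :* y :+ z) :- (a′ :* y :+ z)) refl a a′ y₁ (b * y₂) ⟩
      (a * y₁ + b * y₂) - (a′ * y₁ + b * y₂)   ≡⟨ cong (_- (a′ * y₁ + b * y₂)) eq ⟩
      (a′ * y₁ + b′ * y₂) - (a′ * y₁ + b * y₂) ≡⟨ solve 4 (λ u b′ y b → (u :+ b′ :* y) :- (u :+ b :* y) := (b′ :- b) :* y) refl (a′ * y₁) b′ y₂ b ⟩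
      d * y₂                                   ∎
    y₂/y₁≡ : y₂ * inv y₁ y₁≢0 ≡ inv d d≢0 * (a - a′)
    y₂/y₁≡ = begin
      y₂ * inv y₁ y₁≢0                          ≡⟨ cong (_* inv y₁ y₁≢0) (x*[inv*y]≡y d d≢0 y₂) ⟨
      (d * (inv d d≢0 * y₂)) * inv y₁ y₁≢0      ≡⟨ solve 4 (λ d i y j → (d :* (i :* y)) :* j := i :* (d :* y) :* j) refl d (inv d d≢0) y₂ (inv y₁ y₁≢0) ⟩
      inv d d≢0 * (d * y₂) * inv y₁ y₁≢0        ≡⟨ cong (λ z → inv d d≢0 * z * inv y₁ y₁≢0) [a-a′]y₁≡dy₂ ⟨
      inv d d≢0 * ((a - a′) * y₁) * inv y₁ y₁≢0 ≡⟨ solve 4 (λ i e y j → i :* (e :* y) :* j := i :* e :* (y :* j)) refl (inv d d≢0) (a - a′) y₁ (inv y₁ y₁≢0) ⟩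
      inv d d≢0 * (a - a′) * (y₁ * inv y₁ y₁≢0) ≡⟨ cong (inv d d≢0 * (a - a′) *_) (x*inv≡1 y₁ y₁≢0) ⟩
      inv d d≢0 * (a - a′) * 1#                 ≡⟨ *-identityʳ _ ⟩
      inv d d≢0 * (a - a′)                      ∎

  module FqSubspace {V : Pred Carrier 0ℓ} (V? : Decidable V) (V-subspace : IsFqSubspace V) where

    q≤#V : ∀ {y} → V y → y ≢ 0# → q ≤ count V?
    q≤#V {y} y∈V y≢0 = subst (_≤ count V?) #Fq≡q
      (count-≤-injection enumeration enumeration IsFq? V? (_* y) Fq-multiple∈V (λ _ _ → *-cancelʳ y≢0))
      where
      Fq-multiple∈V : ∀ {c} → IsFq c → V (c * y)
      Fq-multiple∈V {c} c∈Fq = subst V (trans (cong (c * y +_) (zeroˡ y)) (+-identityʳ (c * y)))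
        (V-subspace c∈Fq (Fr.f-0 1) y∈V y∈V)

    q*q≤#V-of-independent : ∀ {y₁ y₂} → V y₁ → V y₂ → (y₁≢0 : y₁ ≢ 0#) → ¬ IsFq (y₂ * inv y₁ y₁≢0) → q ℕ.* q ≤ count V?
    q*q≤#V-of-independent {y₁} {y₂} y₁∈V y₂∈V y₁≢0 y₂∉Fq·y₁ = begin
      q ℕ.* q                                                      ≡⟨ cong₂ ℕ._*_ #Fq≡q #Fq≡q ⟨
      count IsFq? ℕ.* count IsFq?                                  ≡⟨ count-× enumeration enumeration IsFq? IsFq? ⟨
      Counting.count (enumeration ×ᴱ enumeration) (IsFq? ×? IsFq?) ≤⟨ count-≤-injection (enumeration ×ᴱ enumeration) enumeration (IsFq? ×? IsFq?) V?
                                                                span span∈V span-injective ⟩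
      count V?                                             ∎
      where
      open ℕ.≤-Reasoning
      span : Carrier × Carrier → Carrier
      span (a , b) = a * y₁ + b * y₂
      span∈V : ∀ {ab} → IsFq (proj₁ ab) × IsFq (proj₂ ab) → V (span ab)
      span∈V (a∈Fq , b∈Fq) = V-subspace a∈Fq b∈Fq y₁∈V y₂∈V
      span-injective : ∀ {ab ab′} → IsFq (proj₁ ab) × IsFq (proj₂ ab) → IsFq (proj₁ ab′) × IsFq (proj₂ ab′) → span ab ≡ span ab′ → ab ≡ ab′
      span-injective (a∈Fq , b∈Fq) (a′∈Fq , b′∈Fq) = independent⇒span-injective y₁≢0 y₂∉Fq·y₁ a∈Fq b∈Fq a′∈Fq b′∈Fq

    q<#V⇒q*q≤#V : q < count V? → q ℕ.* q ≤ count V?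
    q<#V⇒q*q≤#V q<#V =
      let y₁ , y₁∈V , y₁≢0 = count<⇒∃-difference enumeration V? (_≟ 0#) (ℕ.≤-<-trans (count-≡-≤-1 0#) (ℕ.<-trans 1<q q<#V))
          y₂ , y₂∈V , y₂∉Fq·y₁ = count<⇒∃-difference enumeration V? (λ z → IsFq? (z * inv y₁ y₁≢0)) (ℕ.≤-<-trans (#Fq-multiples≤q y₁≢0) q<#V)
      in q*q≤#V-of-independent y₁∈V y₂∈V y₁≢0 y₂∉Fq·y₁

module Cn-MRD (K : FiniteField) {p k q n : ℕ} (p-prime : Prime p) (1≤k : 1 ≤ k) (q≡pᵏ : q ≡ p ℕ.^ k)
              (4≤n : 4 ≤ n) (card≡qⁿ : FiniteField.card K ≡ q ℕ.^ n) where
  open import Data.List.Properties using (map-cong)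
  open import Data.Product.Properties using (≡-dec)

  open FieldTheory K
  open Extension K p-prime 1≤k q≡pᵏ (ℕ.<-≤-trans ℕ.z<s 4≤n) card≡qⁿ

  g : Carrier → Carrier → Carrier
  g t y = Fr 2 y + Fr 1 y + t * y

  g≡linearized : ∀ t y → g t y ≡ linearized 3 (coeff (t ∷ 1# ∷ 1# ∷ [])) y
  g≡linearized t y = trans (cong (λ z → Fr 2 y + Fr 1 y + t * z) (sym (Fr-zero y)))
    (solve 4 (λ t y u v → v :+ u :+ t :* y := con (ℤ.+ 0) :+ t :* y :+ con (ℤ.+ 1) :* u :+ con (ℤ.+ 1) :* v)
           refl t (Fr 0 y) (Fr 1 y) (Fr 2 y))

  g-linear : ∀ t → IsFqLinear (g t)
  g-linear t = ≗linearized⇒linear 3 (coeff (t ∷ 1# ∷ 1# ∷ [])) (g≡linearized t)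

  #roots-g≤q² : ∀ t → count (λ y → g t y ≟ 0#) ≤ q ℕ.^ 2
  #roots-g≤q² t = ≗linearized⇒#roots≤ (g t) 2 (coeff (t ∷ 1# ∷ 1# ∷ [])) (g≡linearized t) ℕ.≤-refl 1≢0

  traceZero-root? : ∀ t → Decidable (λ y → Trace y ≡ 0# × g t y ≡ 0#)
  traceZero-root? t y = (Trace y ≟ 0#) ×-dec (g t y ≟ 0#)

  module TraceZeroRoots t = FqSubspace (traceZero-root? t)
    (∩-subspace {λ y → Trace y ≡ 0#} {λ y → g t y ≡ 0#} (kernel-subspace Trace Trace-linear) (kernel-subspace (g t) (g-linear t)))

  Triple : Set
  Triple = Carrier × Carrier × Carrier

  0₃ : Triple
  0₃ = 0# , 0# , 0#

  _≟₃_ : (a b : Triple) → Dec (a ≡ b)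
  _≟₃_ = ≡-dec _≟_ (≡-dec _≟_ _≟_)

  _−₃_ : Triple → Triple → Triple
  (a₀ , a₁ , a₂) −₃ (b₀ , b₁ , b₂) = a₀ - b₀ , a₁ - b₁ , a₂ - b₂

  word : Triple → Carrier → Carrier
  word = Code.word (Cn K q n)

  coefficients : Triple → ℕ → Carrier
  coefficients (a₀ , a₁ , a₂) = coeff (a₀ ∷ a₁ ∷ 0# ∷ a₂ ∷ [])

  word≡linearized : ∀ a x → word a x ≡ linearized 4 (coefficients a) x
  word≡linearized (a₀ , a₁ , a₂) x = trans (cong (λ z → a₀ * z + a₁ * Fr 1 x + a₂ * Fr 3 x) (sym (Fr-zero x)))
    (solve 7 (λ a₀ a₁ a₂ x₀ x₁ x₂ x₃ → a₀ :* x₀ :+ a₁ :* x₁ :+ a₂ :* x₃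
                := con (ℤ.+ 0) :+ a₀ :* x₀ :+ a₁ :* x₁ :+ con (ℤ.+ 0) :* x₂ :+ a₂ :* x₃)
           refl a₀ a₁ a₂ (Fr 0 x) (Fr 1 x) (Fr 2 x) (Fr 3 x))

  word-linear : ∀ a → IsFqLinear (word a)
  word-linear a = ≗linearized⇒linear 4 (coefficients a) (word≡linearized a)

  module Word a = AdditiveMap (linear⇒additive (word-linear a))

  word-−₃ : ∀ a b x → word a x - word b x ≡ word (a −₃ b) x
  word-−₃ (a₀ , a₁ , a₂) (b₀ , b₁ , b₂) x =
    solve 9 (λ a₀ a₁ a₂ b₀ b₁ b₂ x u v → (a₀ :* x :+ a₁ :* u :+ a₂ :* v) :- (b₀ :* x :+ b₁ :* u :+ b₂ :* v)
                                         := (a₀ :- b₀) :* x :+ (a₁ :- b₁) :* u :+ (a₂ :- b₂) :* v)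
          refl a₀ a₁ a₂ b₀ b₁ b₂ x (Fr 1 x) (Fr 3 x)

  −₃≡0₃⇒≡ : ∀ {a b} → a −₃ b ≡ 0₃ → a ≡ b
  −₃≡0₃⇒≡ {a₀ , a₁ , a₂} {b₀ , b₁ , b₂} eq =
    cong₂ _,_ (x-y≡0⇒x≡y (cong proj₁ eq)) (cong₂ _,_ (x-y≡0⇒x≡y (cong (proj₁ ∘ proj₂) eq)) (x-y≡0⇒x≡y (cong (proj₂ ∘ proj₂) eq)))

  #ker-word≤q³ : ∀ a → a ≢ 0₃ → Word.#ker a ≤ q ℕ.^ 3
  #ker-word≤q³ a@(a₀ , a₁ , a₂) a≢0 with a₀ ≟ 0# | a₁ ≟ 0# | a₂ ≟ 0#
  ... | no a₀≢0 | _       | _       = ≗linearized⇒#roots≤ (word a) 3 (coefficients a) (word≡linearized a) z≤n a₀≢0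
  ... | yes _   | no a₁≢0 | _       = ≗linearized⇒#roots≤ (word a) 3 (coefficients a) (word≡linearized a) (s≤s z≤n) a₁≢0
  ... | yes _   | yes _   | no a₂≢0 = ≗linearized⇒#roots≤ (word a) 3 (coefficients a) (word≡linearized a) ℕ.≤-refl a₂≢0
  ... | yes refl | yes refl | yes refl = contradiction refl a≢0

  q³<card : q ℕ.^ 3 < card
  q³<card = subst (q ℕ.^ 3 <_) (sym card≡qⁿ) (q^-mono-< 4≤n)

  word-injective : ∀ a b → (∀ x → word a x ≡ word b x) → a ≡ b
  word-injective a b a≗b with (a −₃ b) ≟₃ 0₃
  ... | yes a−b≡0 = −₃≡0₃⇒≡ a−b≡0
  ... | no  a−b≢0 = contradiction (#ker-word≤q³ (a −₃ b) a−b≢0) (ℕ.<⇒≱ (ℕ.<-≤-trans q³<card (begin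
    card                           ≡⟨ count-all ⟨
    count {λ _ → ⊤} (λ _ → yes tt) ≤⟨ count-mono enumeration _ (Word.Kernel? (a −₃ b)) (λ {x} _ → trans (sym (word-−₃ a b x)) (x≡y⇒x-y≡0 (a≗b x))) ⟩
    Word.#ker (a −₃ b)             ∎)))
    where
    open ℕ.≤-Reasoning

  codeSize≡q^[n*3] : codeSize K q n (Cn K q n) ≡ q ℕ.^ (n ℕ.* 3)
  codeSize≡q^[n*3] = begin
    codeSize K q n (Cn K q n)         ≡⟨ cong length (deduplicate-of-distinct _ triples distinct) ⟩
    length triples                    ≡⟨ trans (length-cartesianProduct elems _) (cong (card ℕ.*_) (length-cartesianProduct elems elems)) ⟩
    card ℕ.* (card ℕ.* card)          ≡⟨ cong (λ c → c ℕ.* (c ℕ.* c)) card≡qⁿ ⟩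
    q ℕ.^ n ℕ.* (q ℕ.^ n ℕ.* q ℕ.^ n) ≡⟨ cong (λ z → q ℕ.^ n ℕ.* (q ℕ.^ n ℕ.* z)) (ℕ.*-identityʳ (q ℕ.^ n)) ⟨
    (q ℕ.^ n) ℕ.^ 3                   ≡⟨ ℕ.^-*-assoc q n 3 ⟩
    q ℕ.^ (n ℕ.* 3)                   ∎
    where
    open ≡-Reasoning
    triples : List Triple
    triples = cartesianProduct elems (cartesianProduct elems elems)
    distinct : AllPairs (λ a b → ¬ All (λ x → word a x ≡ word b x) elems) triples
    distinct = AllPairs.map (λ {a} {b} a≢b a≗b → a≢b (word-injective a b (λ x → All.lookup a≗b (complete x))))
                            (Unique.cartesianProduct⁺ unique (Unique.cartesianProduct⁺ unique unique))

  imageSize-of-difference : ∀ a b → imageSize K q n (λ x → word a x - word b x) ≡ Word.#im (a −₃ b)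
  imageSize-of-difference a b =
    trans (cong (λ l → length (deduplicate _≟_ l)) (map-cong (word-−₃ a b) elems)) (Word.#distinct-values≡#im (a −₃ b))

  #ker≡q^e⇒#im≡q^[n∸e] : ∀ c {e} → e ≤ n → Word.#ker c ≡ q ℕ.^ e → Word.#im c ≡ q ℕ.^ (n ∸ e)
  #ker≡q^e⇒#im≡q^[n∸e] c {e} e≤n #ker≡qᵉ = ℕ.*-cancelˡ-≡ _ _ (q ℕ.^ e) {{ℕ.m^n≢0 q e}} (begin
    q ℕ.^ e ℕ.* Word.#im c     ≡⟨ cong (ℕ._* Word.#im c) #ker≡qᵉ ⟨
    Word.#ker c ℕ.* Word.#im c ≡⟨ Word.rank-nullity c ⟨
    card                       ≡⟨ card≡qⁿ ⟩
    q ℕ.^ n                    ≡⟨ cong (q ℕ.^_) (ℕ.m+[n∸m]≡n e≤n) ⟨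
    q ℕ.^ (e ℕ.+ (n ∸ e))      ≡⟨ ℕ.^-distribˡ-+-* q e (n ∸ e) ⟩
    q ℕ.^ e ℕ.* q ℕ.^ (n ∸ e)  ∎)
    where open ≡-Reasoning

  #ker≤q²⇒n∸2≤rank : ∀ c {r} → Word.#ker c ≤ q ℕ.^ 2 → Word.#im c ≡ q ℕ.^ r → n ∸ 2 ≤ r
  #ker≤q²⇒n∸2≤rank c {r} #ker≤q² #im≡qʳ = ℕ.m≤n+o⇒m∸n≤o n 2 (q^-cancel-≤ (begin
    q ℕ.^ n                    ≡⟨ card≡qⁿ ⟨
    card                       ≡⟨ Word.rank-nullity c ⟩
    Word.#ker c ℕ.* Word.#im c ≤⟨ ℕ.*-mono-≤ #ker≤q² (ℕ.≤-reflexive #im≡qʳ) ⟩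
    q ℕ.^ 2 ℕ.* q ℕ.^ r        ≡⟨ ℕ.^-distribˡ-+-* q 2 r ⟨
    q ℕ.^ (2 ℕ.+ r)            ∎))
    where open ℕ.≤-Reasoning

  f : Carrier → Triple
  f t = - t , t - 1# , 1#

  f≢0₃ : ∀ t → f t ≢ 0₃
  f≢0₃ t = 1≢0 ∘ cong (proj₂ ∘ proj₂)

  g∘φ≡word-f : ∀ t x → g t (φ x) ≡ word (f t) x
  g∘φ≡word-f t x = begin
    Fr 2 (Fr 1 x - x) + Fr 1 (Fr 1 x - x) + t * (Fr 1 x - x) ≡⟨ cong₂ (λ u v → u + v + t * (Fr 1 x - x)) (Fr-of-φ 2) (Fr-of-φ 1) ⟩
    (Fr 3 x - Fr 2 x) + (Fr 2 x - Fr 1 x) + t * (Fr 1 x - x) ≡⟨ solve 5 (λ t x u v w → (w :- v) :+ (v :- u) :+ t :* (u :- x)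
                                                                                    := (:- t) :* x :+ (t :- con (ℤ.+ 1)) :* u :+ con (ℤ.+ 1) :* w)
                                                                          refl t x (Fr 1 x) (Fr 2 x) (Fr 3 x) ⟩
    (- t) * x + (t - 1#) * Fr 1 x + 1# * Fr 3 x              ∎
    where
    open ≡-Reasoning
    Fr-of-φ : ∀ i → Fr i (Fr 1 x - x) ≡ Fr (suc i) x - Fr i x
    Fr-of-φ i = trans (Fr.f-sub i (Fr 1 x) x) (cong (_- Fr i x) (Fr-suc i x))

  #ker-f≡q*traceZeroRoots : ∀ t → Word.#ker (f t) ≡ q ℕ.* traceZeroRoots K q n t
  #ker-f≡q*traceZeroRoots t = begin
    Word.#ker (f t)                                   ≡⟨ count-cong enumeration _ _ (trans (g∘φ≡word-f t _)) (trans (sym (g∘φ≡word-f t _))) ⟩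
    count (λ x → g t (φ x) ≟ 0#)                      ≡⟨ φ.#preimage (λ y → g t y ≟ 0#) ⟩
    φ.#ker ℕ.* count ((λ y → g t y ≟ 0#) ∩? φ.Image?) ≡⟨ cong₂ ℕ._*_ #ker-φ≡q (count-cong enumeration _ _
                                                           (λ (gy≡0 , y∈im) → im-φ⊆ker-Trace y∈im , gy≡0)
                                                           (λ (Tr≡0 , gy≡0) → gy≡0 , ker-Trace⊆im-φ Tr≡0)) ⟩
    q ℕ.* traceZeroRoots K q n t                      ∎
    where open ≡-Reasoning

  -- With λ′ = a₂u^(q³) and t = a₁u^q/λ′ + 1, the root u gives a₀u = −(a₁u^q + λ′), whence
  -- word a (u x) = λ′ · word (f t) x.
  rescaling : ∀ a₀ a₁ a₂ {u} → a₂ ≢ 0# → u ≢ 0# → word (a₀ , a₁ , a₂) u ≡ 0# →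
              ∃ λ t → Word.#ker (a₀ , a₁ , a₂) ≤ Word.#ker (f t)
  rescaling a₀ a₁ a₂ {u} a₂≢0 u≢0 root = t , count-≤-injection enumeration enumeration (Word.Kernel? a) (Word.Kernel? (f t))
    (inv u u≢0 *_) maps-into (λ _ _ → *-cancelˡ (inv≢0 u u≢0))
    where
    open ≡-Reasoning
    a : Triple
    a = a₀ , a₁ , a₂
    A λ′ L t : Carrier
    A = a₁ * Fr 1 u
    λ′ = a₂ * Fr 3 u
    λ′≢0 : λ′ ≢ 0#
    λ′≢0 = x*y≢0 a₂≢0 (pow-≢0 (q ℕ.^ 3) u≢0)
    L = inv λ′ λ′≢0
    t = A * L + 1#
    a₀u≡-[A+λ′] : a₀ * u ≡ - (A + λ′)
    a₀u≡-[A+λ′] = begin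
      a₀ * u                       ≡⟨ solve 3 (λ b a l → b := (b :+ a :+ l) :- (a :+ l)) refl (a₀ * u) A λ′ ⟩
      (a₀ * u + A + λ′) - (A + λ′) ≡⟨ cong (_- (A + λ′)) root ⟩
      0# - (A + λ′)                ≡⟨ +-identityˡ _ ⟩
      - (A + λ′)                   ∎
    word-rescaled : ∀ x → word a (u * x) ≡ λ′ * word (f t) x
    word-rescaled x = begin
      a₀ * (u * x) + a₁ * Fr 1 (u * x) + a₂ * Fr 3 (u * x)
        ≡⟨ cong₂ (λ v w → a₀ * (u * x) + a₁ * v + a₂ * w) (Fr-* 1 u x) (Fr-* 3 u x) ⟩
      a₀ * (u * x) + a₁ * (Fr 1 u * Fr 1 x) + a₂ * (Fr 3 u * Fr 3 x)
        ≡⟨ solve 9 (λ a₀ a₁ a₂ u x u₁ x₁ u₃ x₃ → a₀ :* (u :* x) :+ a₁ :* (u₁ :* x₁) :+ a₂ :* (u₃ :* x₃)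
                                                := (a₀ :* u) :* x :+ (a₁ :* u₁) :* x₁ :+ (a₂ :* u₃) :* x₃)
                 refl a₀ a₁ a₂ u x (Fr 1 u) (Fr 1 x) (Fr 3 u) (Fr 3 x) ⟩
      (a₀ * u) * x + A * Fr 1 x + λ′ * Fr 3 x
        ≡⟨ cong (λ z → z * x + A * Fr 1 x + λ′ * Fr 3 x) a₀u≡-[A+λ′] ⟩
      (- (A + λ′)) * x + A * Fr 1 x + λ′ * Fr 3 x
        ≡⟨ cong (λ z → (- (z + λ′)) * x + z * Fr 1 x + λ′ * Fr 3 x) A≡A*λ′L ⟩
      (- (A * (λ′ * L) + λ′)) * x + A * (λ′ * L) * Fr 1 x + λ′ * Fr 3 x
        ≡⟨ solve 6 (λ A l L x x₁ x₃ → (:- (A :* (l :* L) :+ l)) :* x :+ A :* (l :* L) :* x₁ :+ l :* x₃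
                                      := l :* ((:- (A :* L :+ con (ℤ.+ 1))) :* x :+ ((A :* L :+ con (ℤ.+ 1)) :- con (ℤ.+ 1)) :* x₁ :+ con (ℤ.+ 1) :* x₃))
                 refl A λ′ L x (Fr 1 x) (Fr 3 x) ⟩
      λ′ * word (f t) x ∎
      where
      A≡A*λ′L : A ≡ A * (λ′ * L)
      A≡A*λ′L = sym (trans (cong (A *_) (x*inv≡1 λ′ λ′≢0)) (*-identityʳ A))
    maps-into : ∀ {x} → word a x ≡ 0# → word (f t) (inv u u≢0 * x) ≡ 0#
    maps-into {x} ax≡0 = x*y≡0⇒y≡0 λ′≢0 (begin
      λ′ * word (f t) (inv u u≢0 * x) ≡⟨ word-rescaled (inv u u≢0 * x) ⟨
      word a (u * (inv u u≢0 * x))    ≡⟨ cong (word a) (x*[inv*y]≡y u u≢0 x) ⟩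
      word a x                        ≡⟨ ax≡0 ⟩
      0#                              ∎)

  word-without-X^q³ : ∀ a₀ a₁ x → word (a₀ , a₁ , 0#) x ≡ linearized 2 (coeff (a₀ ∷ a₁ ∷ [])) x
  word-without-X^q³ a₀ a₁ x = trans (cong (λ z → a₀ * z + a₁ * Fr 1 x + 0# * Fr 3 x) (sym (Fr-zero x)))
    (solve 5 (λ a₀ a₁ x₀ x₁ x₃ → a₀ :* x₀ :+ a₁ :* x₁ :+ con (ℤ.+ 0) :* x₃ := con (ℤ.+ 0) :+ a₀ :* x₀ :+ a₁ :* x₁)
           refl a₀ a₁ (Fr 0 x) (Fr 1 x) (Fr 3 x))

  #ker≤q-without-X^q³ : ∀ a₀ a₁ → (a₀ , a₁ , 0#) ≢ 0₃ → Word.#ker (a₀ , a₁ , 0#) ≤ q ℕ.^ 1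
  #ker≤q-without-X^q³ a₀ a₁ a≢0 with a₀ ≟ 0#
  ... | no a₀≢0  = ≗linearized⇒#roots≤ _ 1 (coeff (a₀ ∷ a₁ ∷ [])) (word-without-X^q³ a₀ a₁) z≤n a₀≢0
  ... | yes refl = ≗linearized⇒#roots≤ _ 1 (coeff (0# ∷ a₁ ∷ [])) (word-without-X^q³ 0# a₁) ℕ.≤-refl
                     (λ a₁≡0 → a≢0 (cong (λ z → 0# , z , 0#) a₁≡0))

  #ker≤q²-with-X^q³ : (∀ t → traceZeroRoots K q n t ≤ q) → ∀ a₀ a₁ {a₂} → a₂ ≢ 0# → Word.#ker (a₀ , a₁ , a₂) ≤ q ℕ.^ 2
  #ker≤q²-with-X^q³ small a₀ a₁ {a₂} a₂≢0 with Word.#ker (a₀ , a₁ , a₂) ℕ.≤? 1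
  ... | yes #ker≤1 = ℕ.≤-trans #ker≤1 (ℕ.m^n>0 q 2)
  ... | no  #ker≰1 =
    let u , root , u≢0 = count<⇒∃-difference enumeration (Word.Kernel? (a₀ , a₁ , a₂)) (_≟ 0#)
                           (ℕ.≤-<-trans (count-≡-≤-1 0#) (ℕ.≰⇒> #ker≰1))
        t , #ker≤#ker-f = rescaling a₀ a₁ a₂ a₂≢0 u≢0 root
    in begin
      Word.#ker (a₀ , a₁ , a₂)     ≤⟨ #ker≤#ker-f ⟩
      Word.#ker (f t)              ≡⟨ #ker-f≡q*traceZeroRoots t ⟩
      q ℕ.* traceZeroRoots K q n t ≤⟨ ℕ.*-monoʳ-≤ q (small t) ⟩
      q ℕ.* q                      ≡⟨ cong (q ℕ.*_) (ℕ.*-identityʳ q) ⟨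
      q ℕ.^ 2                      ∎
    where open ℕ.≤-Reasoning

  #ker-word≤q² : (∀ t → traceZeroRoots K q n t ≤ q) → ∀ a → a ≢ 0₃ → Word.#ker a ≤ q ℕ.^ 2
  #ker-word≤q² small (a₀ , a₁ , a₂) a≢0 with a₂ ≟ 0#
  ... | yes refl  = ℕ.≤-trans (#ker≤q-without-X^q³ a₀ a₁ a≢0) (q^-mono-≤ {1} {2} (s≤s z≤n))
  ... | no  a₂≢0 = #ker≤q²-with-X^q³ small a₀ a₁ a₂≢0

  x−₃0₃≡x : ∀ a → a −₃ 0₃ ≡ a
  x−₃0₃≡x (a₀ , a₁ , a₂) = cong₂ _,_ (x-0≡x a₀) (cong₂ _,_ (x-0≡x a₁) (x-0≡x a₂))
    where
    x-0≡x : ∀ x → x - 0# ≡ x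
    x-0≡x x = trans (cong (x +_) -0#≈0#) (+-identityʳ x)

  f≉0 : ∀ t → ¬ SameMap K q n (word (f t)) (word 0₃)
  f≉0 t f≗0 = f≢0₃ t (word-injective (f t) 0₃ f≗0)

  rank-f : ∀ t {e} → e ≤ n → Word.#ker (f t) ≡ q ℕ.^ e → HasRank K q n (λ x → word (f t) x - word 0₃ x) (n ∸ e)
  rank-f t e≤n #ker≡qᵉ = trans (imageSize-of-difference (f t) 0₃)
    (trans (cong (λ c → Word.#im c) (x−₃0₃≡x (f t))) (#ker≡q^e⇒#im≡q^[n∸e] (f t) e≤n #ker≡qᵉ))

  codeSize⇒n∸d≡2 : ∀ d → codeSize K q n (Cn K q n) ≡ q ℕ.^ (n ℕ.* (n ∸ d ℕ.+ 1)) → n ∸ d ≡ 2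
  codeSize⇒n∸d≡2 d size = ℕ.+-cancelʳ-≡ 1 (n ∸ d) 2
    (sym (ℕ.*-cancelˡ-≡ 3 (n ∸ d ℕ.+ 1) n (q^-injective (trans (sym codeSize≡q^[n*3]) size))))

  q<traceZeroRoots⇒≡q² : ∀ t → q < traceZeroRoots K q n t → traceZeroRoots K q n t ≡ q ℕ.^ 2
  q<traceZeroRoots⇒≡q² t q<#V = ℕ.≤-antisym
    (ℕ.≤-trans (count-mono enumeration (traceZero-root? t) (λ y → g t y ≟ 0#) proj₂) (#roots-g≤q² t))
    (subst (_≤ traceZeroRoots K q n t) (cong (q ℕ.*_) (sym (ℕ.*-identityʳ q))) (TraceZeroRoots.q<#V⇒q*q≤#V t q<#V))

  -- |V_t| > q would give f_t rank n−3, below the minimum distance n−2 forced by |C_n| = q^(3n).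
  traceZeroRoots≤q-of-MRD : MRD K q n (Cn K q n) → ∀ t → traceZeroRoots K q n t ≤ q
  traceZeroRoots≤q-of-MRD (d , (_ , d≤rank) , size) t = ℕ.≮⇒≥ λ q<#V → ℕ.<⇒≱ (s≤s (s≤s (s≤s z≤n))) (begin
    3           ≡⟨ ℕ.m∸[m∸n]≡n 3≤n ⟨
    n ∸ (n ∸ 3) ≤⟨ ℕ.∸-monoʳ-≤ n (d≤rank (f t) 0₃ (f≉0 t) (n ∸ 3) (rank-f t 3≤n (#ker-f≡q³ q<#V))) ⟩
    n ∸ d       ≡⟨ codeSize⇒n∸d≡2 d size ⟩
    2           ∎)
    where
    open ℕ.≤-Reasoning
    3≤n : 3 ≤ n
    3≤n = ℕ.≤-trans (ℕ.n≤1+n 3) 4≤n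
    #ker-f≡q³ : q < traceZeroRoots K q n t → Word.#ker (f t) ≡ q ℕ.^ 3
    #ker-f≡q³ q<#V = trans (#ker-f≡q*traceZeroRoots t) (cong (q ℕ.*_) (q<traceZeroRoots⇒≡q² t q<#V))

  root-of-g : ∀ {y} (y≢0 : y ≢ 0#) → g (- (Fr 2 y + Fr 1 y) * inv y y≢0) y ≡ 0#
  root-of-g {y} y≢0 = begin
    S + (- S * inv y y≢0) * y ≡⟨ solve 3 (λ s i y → s :+ (:- s :* i) :* y := s :- s :* (y :* i)) refl S (inv y y≢0) y ⟩
    S - S * (y * inv y y≢0)   ≡⟨ cong (λ z → S - S * z) (x*inv≡1 y y≢0) ⟩
    S - S * 1#                ≡⟨ cong (λ z → S - z) (*-identityʳ S) ⟩
    S - S                     ≡⟨ -‿inverseʳ S ⟩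
    0#                        ∎
    where
    open ≡-Reasoning
    S : Carrier
    S = Fr 2 y + Fr 1 y

  nonzero-trace-zero : ∃ λ y → Trace y ≡ 0# × y ≢ 0#
  nonzero-trace-zero =
    let y , y∈im , y≢0 = count<⇒∃-difference enumeration φ.Image? (_≟ 0#) (ℕ.≤-<-trans (count-≡-≤-1 0#) 1<#im-φ)
    in y , im-φ⊆ker-Trace y∈im , y≢0
    where
    1<#im-φ : 1 < φ.#im
    1<#im-φ = subst (1 <_) (sym #im-φ≡q^pred-n) (q^-mono-< {0} (ℕ.≤-trans (s≤s z≤n) (ℕ.pred-mono-≤ 4≤n)))

  q≤traceZeroRoots-somewhere : ∃ λ t → q ≤ traceZeroRoots K q n t
  q≤traceZeroRoots-somewhere =
    let y , Trace-y≡0 , y≢0 = nonzero-trace-zero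
    in _ , TraceZeroRoots.q≤#V _ (Trace-y≡0 , root-of-g y≢0) y≢0

  MRD-of-traceZeroRoots≤q : (∀ t → traceZeroRoots K q n t ≤ q) → MRD K q n (Cn K q n)
  MRD-of-traceZeroRoots≤q small = n ∸ 2 , ((f t₀ , 0₃ , f≉0 t₀ , rank-f t₀ 2≤n #ker-f≡q²) , n∸2≤rank) , size
    where
    2≤n : 2 ≤ n
    2≤n = ℕ.≤-trans (s≤s (s≤s z≤n)) 4≤n
    t₀ : Carrier
    t₀ = proj₁ q≤traceZeroRoots-somewhere
    #ker-f≡q² : Word.#ker (f t₀) ≡ q ℕ.^ 2
    #ker-f≡q² = trans (#ker-f≡q*traceZeroRoots t₀)
      (cong (q ℕ.*_) (trans (ℕ.≤-antisym (small t₀) (proj₂ q≤traceZeroRoots-somewhere)) (sym (ℕ.*-identityʳ q))))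
    n∸2≤rank : ∀ a b → ¬ SameMap K q n (word a) (word b) → ∀ r → HasRank K q n (λ x → word a x - word b x) r → n ∸ 2 ≤ r
    n∸2≤rank a b a≉b r rank = #ker≤q²⇒n∸2≤rank (a −₃ b)
      (#ker-word≤q² small (a −₃ b) (λ a−b≡0 → a≉b (λ x → cong (λ c → word c x) (−₃≡0₃⇒≡ a−b≡0))))
      (trans (sym (imageSize-of-difference a b)) rank)
    size : codeSize K q n (Cn K q n) ≡ q ℕ.^ (n ℕ.* (n ∸ (n ∸ 2) ℕ.+ 1))
    size = trans codeSize≡q^[n*3] (cong (λ m → q ℕ.^ (n ℕ.* (m ℕ.+ 1))) (sym (ℕ.m∸[m∸n]≡n 2≤n)))


proposition4p3 : (q n : ℕ) → PrimePower q → 4 ≤ n →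
    (K : FiniteField) → FiniteField.card K ≡ q ^ n →
    (MRD K q n (Cn K q n) → (∀ t → traceZeroRoots K q n t ≤ q))
    × ((∀ t → traceZeroRoots K q n t ≤ q) → MRD K q n (Cn K q n))
proposition4p3 q n (p , k , p-prime , 1≤k , q≡pᵏ) 4≤n K card≡qⁿ =
  traceZeroRoots≤q-of-MRD , MRD-of-traceZeroRoots≤q
  where open Cn-MRD K p-prime 1≤k q≡pᵏ 4≤n card≡qⁿ
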